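{- Let $T$ be a finite rooted tree with root $v_0$, regarded as a poset in which the root $v_0$ is the maximum element (so $x < y$ means that $y$ lies on the path from $x$ to the root, $y \neq x$). Let $\mathcal{A}(T)$ be the set of $T$-partitions, i.e. maps $\sigma : T \to \mathbb{N}=\{0,1,2,\dots\}$ such that $\sigma(x) \ge \sigma(y)$ whenever $x \le y$. Let $z_v$ ($v \in T$) be indeterminates, and for $\sigma \in \mathcal{A}(T)$ put $\mathbf{z}^\sigma = \prod_{v \in T} z_v^{\sigma(v)}$. For $v \in T$ put $\mathbf{z}[H_T(v)] = \prod_{w \in T,\, w \le v} z_w$. Define the weight $$ W_T(\sigma;q,t) = f_{q,t}(\sigma(v_0);0)\prod_{\substack{x,y \in T \\ y \text{ covers } x}} f_{q,t}(\sigma(x)-\sigma(y);0), $$ where for $n \in \mathbb{N}$, $f_{q,t}(n;0) = \dfrac{(t;q)_n}{(q;q)_n}$. Then, as formal power series in the $z_v$, $$ \sum_{\sigma \in \mathcal{A}(T)} W_T(\sigma;q,t)\, \mathbf{z}^\sigma = \prod_{v \in T} F\big(\mathbf{z}[H_T(v)];q,t\big), $$ where $F(x;q,t) = \dfrac{(tx;q)_\infty}{(x;q)_\infty}$.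
   Context: Here $(a;q)_n = \prod_{i=0}^{n-1}(1-aq^i)$ and $(a;q)_\infty = \prod_{i\ge 0}(1-aq^i)$ are $q$-shifted factorials; $q,t$ are indeterminates. "$y$ covers $x$" means $x<y$ and there is no element strictly between them, i.e. $y$ is the parent of $x$ in the tree. The weight $W_T$ is the specialization to rooted trees (whose top tree is the whole tree and whose $d$-complete coloring is the identity) of the paper's general $(q,t)$-weight for $d$-complete posets; the statement is the paper's conjectured $(q,t)$-deformation of the Peterson–Proctor hook formula in the case of rooted trees. -}

module Defs where

open import Data.Nat as ℕ using (ℕ; zero; suc; _∸_; _≤_; _≤?_)
open import Data.Integer as ℤ using (ℤ; 0ℤ; 1ℤ)
open import Data.Fin as Fin using (Fin; zero; suc; toℕ)
open import Data.Fin.Properties using (all?)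
open import Data.Vec as Vec using (Vec; []; _∷_; zipWith; tabulate; lookup)
open import Data.Vec.Properties using (≡-dec)
open import Data.List as List using (List; []; _∷_; upTo; concatMap; allFin)
open import Data.List.Membership.Propositional using (_∈_)
import Data.List.Membership.DecPropositional as DecMem
open import Data.Bool using (Bool; if_then_else_)
open import Relation.Nullary using (Dec; does)
open import Relation.Nullary.Decidable using (_→-dec_)

-- A rooted tree with (suc n) vertices has vertex set Fin (suc n), root
-- zero, and the non-root vertex (suc i) has parent (parent i), whose
-- label is strictly smaller.  Every finite rooted tree admits such a
-- labelling (e.g. breadth-first order), and the statement is invariant
-- under relabelling.

record RootedTree (n : ℕ) : Set where
  field
    parent  : Fin n → Fin (suc n)
    parent< : ∀ i → toℕ (parent i) ≤ toℕ i
open RootedTree public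

Vertex : ℕ → Set
Vertex n = Fin (suc n)

root : ∀ {n} → Vertex n
root = zero

-- the path from a vertex to the root (fuel = label, always sufficient
-- because labels strictly decrease along the path)
chain : ∀ {n} → RootedTree n → ℕ → Vertex n → List (Vertex n)
chain T _       zero    = zero ∷ []
chain T zero    (suc i) = suc i ∷ []
chain T (suc f) (suc i) = suc i ∷ chain T f (parent T i)

pathToRoot : ∀ {n} → RootedTree n → Vertex n → List (Vertex n)
pathToRoot T v = chain T (toℕ v) v

_⊢_≼_ : ∀ {n} → RootedTree n → Vertex n → Vertex n → Set
T ⊢ x ≼ y = y ∈ pathToRoot T x

_⊢_≼?_ : ∀ {n} (T : RootedTree n) x y → Dec (T ⊢ x ≼ y)
T ⊢ x ≼? y = DecMem._∈?_ Fin._≟_ y (pathToRoot T x)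

IsTPartition : ∀ {n} → RootedTree n → (Vertex n → ℕ) → Set
IsTPartition T σ = ∀ x y → T ⊢ x ≼ y → σ y ≤ σ x

isTPartition? : ∀ {n} (T : RootedTree n) σ → Dec (IsTPartition T σ)
isTPartition? T σ = all? λ x → all? λ y → (T ⊢ x ≼? y) →-dec (σ y ≤? σ x)

Exp : ℕ → Set
Exp m = Vec ℕ m

PS : ℕ → Set
PS m = Exp m → ℤ

sumℤ : List ℤ → ℤ
sumℤ = List.foldr ℤ._+_ 0ℤ

below : ∀ {m} → Exp m → List (Exp m)
below []      = [] ∷ []
below (k ∷ e) = concatMap (λ i → List.map (i ∷_) (below e)) (upTo (suc k))

zeroE : ∀ {m} → Exp m
zeroE = Vec.replicate _ 0

_+E_ : ∀ {m} → Exp m → Exp m → Exp m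
_+E_ = zipWith ℕ._+_

_∸E_ : ∀ {m} → Exp m → Exp m → Exp m
_∸E_ = zipWith _∸_

scaleE : ∀ {m} → ℕ → Exp m → Exp m
scaleE k = Vec.map (k ℕ.*_)

totalDeg : ∀ {m} → Exp m → ℕ
totalDeg = Vec.foldr _ ℕ._+_ 0

mono : ∀ {m} → Exp m → PS m
mono d e = if does (≡-dec ℕ._≟_ d e) then 1ℤ else 0ℤ

oneP : ∀ {m} → PS m
oneP = mono zeroE

_-P_ : ∀ {m} → PS m → PS m → PS m
(a -P b) e = a e ℤ.- b e

_*P_ : ∀ {m} → PS m → PS m → PS m
(a *P b) e = sumℤ (List.map (λ d → a d ℤ.* b (e ∸E d)) (below e))

prodP : ∀ {m} → List (PS m) → PS m
prodP = List.foldr _*P_ oneP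

-- geometric series 1/(1 - x^d) = Σ_k x^(k d), for d ≠ 0
-- (terms with k > total degree of e cannot contribute to the coefficient of e)
geomP : ∀ {m} → Exp m → PS m
geomP d e = sumℤ (List.map (λ k → mono (scaleE k d) e) (upTo (suc (totalDeg e))))

-- Variables: index 0 is q, index 1 is t, index 2+v is z_v.
-- An exponent vector is  a ∷ b ∷ s  meaning  q^a t^b z^s.

Var : ℕ → ℕ
Var N = suc (suc N)

qdeg : ∀ {N} → Exp (Var N) → ℕ
qdeg (a ∷ _ ∷ _) = a

-- Infinite product Π_{i ≥ 0} g i, where g i ≡ 1 modulo q^i for i ≥ 1:
-- the coefficient of e only depends on the factors i ≤ (q-degree of e).
infProdP : ∀ {N} → (ℕ → PS (Var N)) → PS (Var N)
infProdP g e = prodP (List.map g (upTo (suc (qdeg e)))) e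

tqPoch : ∀ {N} → ℕ → PS (Var N)
tqPoch n = prodP (List.map (λ i → oneP -P mono (i ∷ 1 ∷ zeroE)) (upTo n))

invqqPoch : ∀ {N} → ℕ → PS (Var N)
invqqPoch n = prodP (List.map (λ i → geomP (suc i ∷ 0 ∷ zeroE)) (upTo n))

fqt : ∀ {N} → ℕ → PS (Var N)
fqt n = tqPoch n *P invqqPoch n

Fqt : ∀ {N} → Exp N → PS (Var N)
Fqt s = infProdP λ i → (oneP -P mono (i ∷ 1 ∷ s)) *P geomP (i ∷ 0 ∷ s)

-- W_T(σ;q,t) = f(σ(v0);0) Π_{y covers x} f(σ(x) - σ(y);0)
-- (y covers x iff y is the parent of x)
weight : ∀ {n} → RootedTree n → (Vertex n → ℕ) → PS (Var (suc n))
weight T σ =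
  fqt (σ root) *P
  prodP (List.map (λ i → fqt (σ (suc i) ∸ σ (parent T i))) (allFin _))

-- Σ_{σ ∈ A(T)} W_T(σ) z^σ ; only σ ≤ s can contribute to the
-- coefficient of q^a t^b z^s.
lhsSeries : ∀ {n} → RootedTree n → PS (Var (suc n))
lhsSeries T e@(a ∷ b ∷ s) = sumℤ (List.map term (below s))
  where
  term : Exp _ → ℤ
  term σ = if does (isTPartition? T (lookup σ))
             then (weight T (lookup σ) *P mono (0 ∷ 0 ∷ σ)) e
             else 0ℤ

hookExp : ∀ {n} → RootedTree n → Vertex n → Exp (suc n)
hookExp T v = tabulate λ w → if does (T ⊢ w ≼? v) then 1 else 0

rhsSeries : ∀ {n} → RootedTree n → PS (Var (suc n))
rhsSeries T = prodP (List.map (λ v → Fqt (hookExp T v)) (allFin _))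

-- By the q-binomial theorem F(x) = Σ_k f(k;0) x^k,
-- so the right-hand side expands as Σ_κ Π_v f(κ v;0) z^(Σ_v κ v · H(v)) over κ : T → ℕ.
-- The exponent Σ_v κ v · H(v) assigns to each vertex the sum of κ over its ancestors; this
-- is a bijection from such κ onto the T-partitions σ, with inverse
-- κ v = σ v - σ (parent v), and under it Π_v f(κ v;0) is exactly the weight W_T(σ).
-- All series are coefficient functions, so each identity is only needed up to the total
-- degree of the exponent, where every infinite sum and product is finite.

module Submission where

open import Defs
open import Data.Nat using (ℕ; zero; suc; z≤n; s≤s; _≤_; _<_; _∸_)
import Data.Nat as ℕ
import Data.Nat.Properties as ℕ
open import Data.Integer using (ℤ; 0ℤ; 1ℤ; -1ℤ; _+_; _*_; -_; _-_)
import Data.Integer as ℤ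
import Data.Integer.Properties as ℤ
open import Data.Fin as Fin using (Fin)
open import Data.Vec using (Vec; []; _∷_; lookup)
import Data.Vec.Properties as Vec
open import Data.Vec.Relation.Binary.Pointwise.Inductive as Pointwise using (Pointwise; []; _∷_)
open import Data.List as List using (List; []; _∷_; _++_; upTo; allFin; applyUpTo)
import Data.List.Properties as List
open import Data.Bool using (Bool; true; false; _∧_; _∨_; if_then_else_)
import Data.Bool.Properties as Bool
open import Data.List.Membership.Propositional using (_∈_)
open import Data.List.Relation.Unary.Any using (here; there)
open import Data.Product using (_×_; _,_; proj₁; proj₂)
open import Data.Empty using (⊥-elim)
open import Relation.Nullary using (Dec; yes; no; does; ¬_)
open import Relation.Nullary.Decidable using (dec-true; dec-false)
open import Relation.Binary.PropositionalEquality
  using (_≡_; refl; sym; trans; cong; cong₂; subst; subst₂; _≗_)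
open import Data.Vec.Functional using () renaming (_∷_ to _∷ᶠ_)
open import Function using (_∘_; id)
open import Data.Nat.Tactic.RingSolver using () renaming (solve-∀ to ℕ-solve-∀)
open import Data.Integer.Tactic.RingSolver using () renaming (solve-∀ to ℤ-solve-∀)
import Algebra.Properties.CommutativeSemigroup as CommutativeSemigroup
module ℤ+ = CommutativeSemigroup ℤ.+-commutativeSemigroup
module ℕ+ = CommutativeSemigroup ℕ.+-commutativeSemigroup
open import Relation.Binary.PropositionalEquality.Properties using (module ≡-Reasoning)
open ≡-Reasoning

∑< : ℕ → (ℕ → ℤ) → ℤ
∑< zero    f = 0ℤ
∑< (suc k) f = ∑< k f + f k

∑<-cong : ∀ k {f g : ℕ → ℤ} → (∀ i → i < k → f i ≡ g i) → ∑< k f ≡ ∑< k g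
∑<-cong zero    p = refl
∑<-cong (suc k) p = cong₂ _+_ (∑<-cong k (λ i i<k → p i (ℕ.m<n⇒m<1+n i<k))) (p k ℕ.≤-refl)

∑<-ext : ∀ k {f g : ℕ → ℤ} → (∀ i → f i ≡ g i) → ∑< k f ≡ ∑< k g
∑<-ext k p = ∑<-cong k (λ i _ → p i)

∑<-suc : ∀ k f → ∑< (suc k) f ≡ f 0 + ∑< k (f ∘ suc)
∑<-suc zero    f = ℤ.+-comm 0ℤ (f 0)
∑<-suc (suc k) f = begin
  (∑< k f + f k) + f (suc k)           ≡⟨ cong (_+ f (suc k)) (∑<-suc k f) ⟩
  (f 0 + ∑< k (f ∘ suc)) + f (suc k)   ≡⟨ ℤ.+-assoc (f 0) _ _ ⟩
  f 0 + (∑< k (f ∘ suc) + f (suc k))   ∎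

∑<-+ : ∀ k f g → ∑< k (λ i → f i + g i) ≡ ∑< k f + ∑< k g
∑<-+ zero    f g = refl
∑<-+ (suc k) f g = trans (cong (_+ (f k + g k)) (∑<-+ k f g)) (ℤ+.interchange (∑< k f) (∑< k g) (f k) (g k))

∑<-zero : ∀ k → ∑< k (λ _ → 0ℤ) ≡ 0ℤ
∑<-zero zero    = refl
∑<-zero (suc k) = trans (ℤ.+-identityʳ _) (∑<-zero k)

*-∑< : ∀ k c f → c * ∑< k f ≡ ∑< k (λ i → c * f i)
*-∑< zero    c f = ℤ.*-zeroʳ c
*-∑< (suc k) c f = trans (ℤ.*-distribˡ-+ c (∑< k f) (f k)) (cong (_+ c * f k) (*-∑< k c f))

neg-∑< : ∀ k f → - ∑< k f ≡ ∑< k (λ i → - f i)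
neg-∑< k f = trans (sym (ℤ.-1*i≡-i _)) (trans (*-∑< k -1ℤ f) (∑<-ext k (λ i → ℤ.-1*i≡-i (f i))))

∑<-vanishing-tail : ∀ n K (f : ℕ → ℤ) → (∀ k → n ≤ k → f k ≡ 0ℤ) → n ≤ K → ∑< K f ≡ ∑< n f
∑<-vanishing-tail n zero f z z≤n = refl
∑<-vanishing-tail n (suc K) f z n≤1+K with n ℕ.≟ suc K
... | yes refl = refl
... | no n≢1+K = trans (cong₂ _+_ (∑<-vanishing-tail n K f z n≤K) (z K n≤K)) (ℤ.+-identityʳ _)
  where
  n≤K : n ≤ K
  n≤K = ℕ.≤-pred (ℕ.≤∧≢⇒< n≤1+K n≢1+K)

∑<-triangle : ∀ k (H : ℕ → ℕ → ℤ) →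
  ∑< k (λ i → ∑< (suc i) (λ j → H j i)) ≡ ∑< k (λ j → ∑< (k ∸ j) (λ l → H j (j ℕ.+ l)))
∑<-triangle zero    H = refl
∑<-triangle (suc k) H = begin
  ∑< k (λ i → ∑< (suc i) (λ j → H j i)) + (∑< k (λ j → H j k) + H k k)
    ≡⟨ cong (_+ (∑< k (λ j → H j k) + H k k)) (∑<-triangle k H) ⟩
  R + (∑< k (λ j → H j k) + H k k)
    ≡⟨ sym (ℤ.+-assoc R _ _) ⟩
  (R + ∑< k (λ j → H j k)) + H k k
    ≡⟨ cong₂ _+_ (sym (∑<-+ k _ _)) (cong (H k) (sym (ℕ.+-identityʳ k))) ⟩
  ∑< k (λ j → row k j + H j k) + H k (k ℕ.+ 0)
    ≡⟨ cong₂ _+_ (∑<-cong k (λ j j<k → sym (row-suc j (ℕ.<⇒≤ j<k)))) (sym (ℤ.+-identityˡ _)) ⟩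
  ∑< k (row (suc k)) + ∑< 1 (λ l → H k (k ℕ.+ l))
    ≡⟨ cong (λ x → ∑< k (row (suc k)) + ∑< x (λ l → H k (k ℕ.+ l))) (sym (ℕ.m+n∸n≡m 1 k)) ⟩
  ∑< (suc k) (row (suc k)) ∎
  where
  row : ℕ → ℕ → ℤ
  row k j = ∑< (k ∸ j) (λ l → H j (j ℕ.+ l))
  R : ℤ
  R = ∑< k (row k)
  row-suc : ∀ j → j ≤ k → row (suc k) j ≡ row k j + H j k
  row-suc j j≤k rewrite ℕ.+-∸-assoc 1 j≤k =
    cong (λ x → row k j + H j x) (ℕ.m+[n∸m]≡n j≤k)

∑<-reverse : ∀ k (f : ℕ → ℤ) → ∑< (suc k) f ≡ ∑< (suc k) (λ i → f (k ∸ i))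
∑<-reverse zero    f = refl
∑<-reverse (suc k) f = begin
  ∑< (suc (suc k)) f                          ≡⟨ ∑<-suc (suc k) f ⟩
  f 0 + ∑< (suc k) (f ∘ suc)                  ≡⟨ cong (f 0 +_) (∑<-reverse k (f ∘ suc)) ⟩
  f 0 + ∑< (suc k) (λ i → f (suc (k ∸ i)))    ≡⟨ ℤ.+-comm (f 0) _ ⟩
  ∑< (suc k) (λ i → f (suc (k ∸ i))) + f 0
    ≡⟨ cong₂ _+_ (∑<-cong (suc k) (λ { i (s≤s i≤k) → cong f (sym (ℕ.+-∸-assoc 1 i≤k)) }))
                 (cong f (sym (ℕ.n∸n≡0 k))) ⟩
  ∑< (suc (suc k)) (λ i → f (suc k ∸ i))      ∎

sumℤ-map-++ : ∀ {A : Set} (f : A → ℤ) xs ys →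
  sumℤ (List.map f (xs ++ ys)) ≡ sumℤ (List.map f xs) + sumℤ (List.map f ys)
sumℤ-map-++ f []       ys = sym (ℤ.+-identityˡ _)
sumℤ-map-++ f (x ∷ xs) ys =
  trans (cong (f x +_) (sumℤ-map-++ f xs ys)) (sym (ℤ.+-assoc (f x) _ _))

sumℤ-map-concatMap : ∀ {A B : Set} (f : B → ℤ) (g : A → List B) xs →
  sumℤ (List.map f (List.concatMap g xs)) ≡ sumℤ (List.map (λ x → sumℤ (List.map f (g x))) xs)
sumℤ-map-concatMap f g []       = refl
sumℤ-map-concatMap f g (x ∷ xs) = trans (sumℤ-map-++ f (g x) (List.concatMap g xs))
  (cong (sumℤ (List.map f (g x)) +_) (sumℤ-map-concatMap f g xs))

sumℤ-map-applyUpTo : ∀ (f : ℕ → ℤ) g k → sumℤ (List.map f (applyUpTo g k)) ≡ ∑< k (f ∘ g)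
sumℤ-map-applyUpTo f g zero    = refl
sumℤ-map-applyUpTo f g (suc k) =
  trans (cong (f (g 0) +_) (sumℤ-map-applyUpTo f (g ∘ suc) k)) (sym (∑<-suc k (f ∘ g)))

sumℤ-map-upTo : ∀ (f : ℕ → ℤ) k → sumℤ (List.map f (upTo k)) ≡ ∑< k f
sumℤ-map-upTo f = sumℤ-map-applyUpTo f id

infix 4 _≤E_ _≤E?_

_≤E_ : ∀ {m} → Exp m → Exp m → Set
_≤E_ = Pointwise _≤_

_≤E?_ : ∀ {m} (u v : Exp m) → Dec (u ≤E v)
_≤E?_ = Pointwise.decidable ℕ._≤?_

∑≤ : ∀ {m} → Exp m → (Exp m → ℤ) → ℤ
∑≤ e F = sumℤ (List.map F (below e))

∑≤-∷ : ∀ {m} k (e : Exp m) F → ∑≤ (k ∷ e) F ≡ ∑< (suc k) (λ i → ∑≤ e (λ d → F (i ∷ d)))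
∑≤-∷ k e F = begin
  sumℤ (List.map F (List.concatMap (λ i → List.map (i ∷_) (below e)) (upTo (suc k))))
    ≡⟨ sumℤ-map-concatMap F (λ i → List.map (i ∷_) (below e)) (upTo (suc k)) ⟩
  sumℤ (List.map (λ i → sumℤ (List.map F (List.map (i ∷_) (below e)))) (upTo (suc k)))
    ≡⟨ sumℤ-map-upTo _ (suc k) ⟩
  ∑< (suc k) (λ i → sumℤ (List.map F (List.map (i ∷_) (below e))))
    ≡⟨ ∑<-ext (suc k) (λ i → cong sumℤ (sym (List.map-∘ (below e)))) ⟩
  ∑< (suc k) (λ i → ∑≤ e (λ d → F (i ∷ d))) ∎

∑≤-ext : ∀ {m} (e : Exp m) {F G} → (∀ d → F d ≡ G d) → ∑≤ e F ≡ ∑≤ e G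
∑≤-ext e p = cong sumℤ (List.map-cong p (below e))

∑≤-cong : ∀ {m} (e : Exp m) {F G} → (∀ d → d ≤E e → F d ≡ G d) → ∑≤ e F ≡ ∑≤ e G
∑≤-cong []      p = cong (_+ 0ℤ) (p [] [])
∑≤-cong (k ∷ e) {F} {G} p = begin
  ∑≤ (k ∷ e) F                            ≡⟨ ∑≤-∷ k e F ⟩
  ∑< (suc k) (λ i → ∑≤ e (λ d → F (i ∷ d)))
    ≡⟨ ∑<-cong (suc k) (λ { i (s≤s i≤k) → ∑≤-cong e (λ d d≤e → p (i ∷ d) (i≤k ∷ d≤e)) }) ⟩
  ∑< (suc k) (λ i → ∑≤ e (λ d → G (i ∷ d))) ≡⟨ sym (∑≤-∷ k e G) ⟩
  ∑≤ (k ∷ e) G                            ∎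

∑≤-+ : ∀ {m} (e : Exp m) F G → ∑≤ e (λ d → F d + G d) ≡ ∑≤ e F + ∑≤ e G
∑≤-+ []      F G = begin
  (F [] + G []) + 0ℤ          ≡⟨ ℤ.+-identityʳ _ ⟩
  F [] + G []                 ≡⟨ sym (cong₂ _+_ (ℤ.+-identityʳ (F [])) (ℤ.+-identityʳ (G []))) ⟩
  (F [] + 0ℤ) + (G [] + 0ℤ)   ∎
∑≤-+ (k ∷ e) F G = begin
  ∑≤ (k ∷ e) (λ d → F d + G d)
    ≡⟨ ∑≤-∷ k e _ ⟩
  ∑< (suc k) (λ i → ∑≤ e (λ d → F (i ∷ d) + G (i ∷ d)))
    ≡⟨ ∑<-ext (suc k) (λ i → ∑≤-+ e _ _) ⟩
  ∑< (suc k) (λ i → ∑≤ e (λ d → F (i ∷ d)) + ∑≤ e (λ d → G (i ∷ d)))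
    ≡⟨ ∑<-+ (suc k) _ _ ⟩
  ∑< (suc k) (λ i → ∑≤ e (λ d → F (i ∷ d))) + ∑< (suc k) (λ i → ∑≤ e (λ d → G (i ∷ d)))
    ≡⟨ sym (cong₂ _+_ (∑≤-∷ k e F) (∑≤-∷ k e G)) ⟩
  ∑≤ (k ∷ e) F + ∑≤ (k ∷ e) G ∎

*-∑≤ : ∀ {m} (e : Exp m) c F → c * ∑≤ e F ≡ ∑≤ e (λ d → c * F d)
*-∑≤ []      c F = trans (ℤ.*-distribˡ-+ c (F []) 0ℤ) (cong (c * F [] +_) (ℤ.*-zeroʳ c))
*-∑≤ (k ∷ e) c F = begin
  c * ∑≤ (k ∷ e) F                              ≡⟨ cong (c *_) (∑≤-∷ k e F) ⟩
  c * ∑< (suc k) (λ i → ∑≤ e (λ d → F (i ∷ d))) ≡⟨ *-∑< (suc k) c _ ⟩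
  ∑< (suc k) (λ i → c * ∑≤ e (λ d → F (i ∷ d))) ≡⟨ ∑<-ext (suc k) (λ i → *-∑≤ e c _) ⟩
  ∑< (suc k) (λ i → ∑≤ e (λ d → c * F (i ∷ d))) ≡⟨ sym (∑≤-∷ k e _) ⟩
  ∑≤ (k ∷ e) (λ d → c * F d)                    ∎

∑≤-zero : ∀ {m} (e : Exp m) → ∑≤ e (λ _ → 0ℤ) ≡ 0ℤ
∑≤-zero e = trans (sym (*-∑≤ e 0ℤ (λ _ → 0ℤ))) (ℤ.*-zeroˡ (∑≤ e (λ _ → 0ℤ)))

neg-∑≤ : ∀ {m} (e : Exp m) F → - ∑≤ e F ≡ ∑≤ e (λ d → - F d)
neg-∑≤ e F = trans (sym (ℤ.-1*i≡-i _)) (trans (*-∑≤ e -1ℤ F) (∑≤-ext e (λ d → ℤ.-1*i≡-i (F d))))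

∑<-∑≤-comm : ∀ {m} k (e : Exp m) (F : ℕ → Exp m → ℤ) →
  ∑< k (λ i → ∑≤ e (F i)) ≡ ∑≤ e (λ d → ∑< k (λ i → F i d))
∑<-∑≤-comm zero    e F = sym (∑≤-zero e)
∑<-∑≤-comm (suc k) e F = begin
  ∑< k (λ i → ∑≤ e (F i)) + ∑≤ e (F k)        ≡⟨ cong (_+ ∑≤ e (F k)) (∑<-∑≤-comm k e F) ⟩
  ∑≤ e (λ d → ∑< k (λ i → F i d)) + ∑≤ e (F k) ≡⟨ sym (∑≤-+ e _ _) ⟩
  ∑≤ e (λ d → ∑< k (λ i → F i d) + F k d)      ∎

∑≤-triangle : ∀ {m} (e : Exp m) (F : Exp m → Exp m → ℤ) →
  ∑≤ e (λ d → ∑≤ d (λ d' → F d' d)) ≡ ∑≤ e (λ d' → ∑≤ (e ∸E d') (λ d'' → F d' (d' +E d'')))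
∑≤-triangle []      F = refl
∑≤-triangle (k ∷ e) F = begin
  ∑≤ (k ∷ e) (λ d → ∑≤ d (λ d' → F d' d))
    ≡⟨ ∑≤-∷ k e _ ⟩
  ∑< (suc k) (λ i → ∑≤ e (λ d → ∑≤ (i ∷ d) (λ d' → F d' (i ∷ d))))
    ≡⟨ ∑<-ext (suc k) (λ i → ∑≤-ext e (λ d → ∑≤-∷ i d _)) ⟩
  ∑< (suc k) (λ i → ∑≤ e (λ d → ∑< (suc i) (λ j → ∑≤ d (λ d' → F (j ∷ d') (i ∷ d)))))
    ≡⟨ ∑<-ext (suc k) (λ i → sym (∑<-∑≤-comm (suc i) e _)) ⟩
  ∑< (suc k) (λ i → ∑< (suc i) (λ j → ∑≤ e (λ d → ∑≤ d (λ d' → F (j ∷ d') (i ∷ d)))))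
    ≡⟨ ∑<-ext (suc k) (λ i → ∑<-ext (suc i) (λ j → ∑≤-triangle e (λ d' d → F (j ∷ d') (i ∷ d)))) ⟩
  ∑< (suc k) (λ i → ∑< (suc i) (λ j → G j i))
    ≡⟨ ∑<-triangle (suc k) G ⟩
  ∑< (suc k) (λ j → ∑< (suc k ∸ j) (λ l → G j (j ℕ.+ l)))
    ≡⟨ ∑<-cong (suc k) (λ { j (s≤s j≤k) → cong (λ x → ∑< x (λ l → G j (j ℕ.+ l))) (ℕ.+-∸-assoc 1 j≤k) }) ⟩
  ∑< (suc k) (λ j → ∑< (suc (k ∸ j)) (λ l → G j (j ℕ.+ l)))
    ≡⟨ ∑<-ext (suc k) (λ j → ∑<-∑≤-comm (suc (k ∸ j)) e _) ⟩
  ∑< (suc k) (λ j → ∑≤ e (λ d' → ∑< (suc (k ∸ j)) (λ l → ∑≤ (e ∸E d') (λ d'' → F (j ∷ d') ((j ℕ.+ l) ∷ (d' +E d''))))))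
    ≡⟨ ∑<-ext (suc k) (λ j → ∑≤-ext e (λ d' → sym (∑≤-∷ (k ∸ j) (e ∸E d') _))) ⟩
  ∑< (suc k) (λ j → ∑≤ e (λ d' → ∑≤ ((k ∸ j) ∷ (e ∸E d')) (λ d'' → F (j ∷ d') ((j ∷ d') +E d''))))
    ≡⟨ sym (∑≤-∷ k e _) ⟩
  ∑≤ (k ∷ e) (λ d' → ∑≤ ((k ∷ e) ∸E d') (λ d'' → F d' (d' +E d''))) ∎
  where
  G : ℕ → ℕ → ℤ
  G j i = ∑≤ e (λ d' → ∑≤ (e ∸E d') (λ d'' → F (j ∷ d') (i ∷ (d' +E d''))))

∑≤-reverse : ∀ {m} (e : Exp m) F → ∑≤ e F ≡ ∑≤ e (λ d → F (e ∸E d))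
∑≤-reverse []      F = refl
∑≤-reverse (k ∷ e) F = begin
  ∑≤ (k ∷ e) F                                      ≡⟨ ∑≤-∷ k e F ⟩
  ∑< (suc k) (λ i → ∑≤ e (λ d → F (i ∷ d)))          ≡⟨ ∑<-ext (suc k) (λ i → ∑≤-reverse e _) ⟩
  ∑< (suc k) (λ i → ∑≤ e (λ d → F (i ∷ (e ∸E d))))   ≡⟨ ∑<-reverse k _ ⟩
  ∑< (suc k) (λ i → ∑≤ e (λ d → F ((k ∸ i) ∷ (e ∸E d)))) ≡⟨ sym (∑≤-∷ k e _) ⟩
  ∑≤ (k ∷ e) (λ d → F ((k ∷ e) ∸E d))                 ∎

⟦_⟧ : Bool → ℤ
⟦ b ⟧ = if b then 1ℤ else 0ℤ

⟦∧⟧ : ∀ x y → ⟦ x ∧ y ⟧ ≡ ⟦ x ⟧ * ⟦ y ⟧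
⟦∧⟧ true  y = sym (ℤ.*-identityˡ ⟦ y ⟧)
⟦∧⟧ false y = sym (ℤ.*-zeroˡ ⟦ y ⟧)

if-then-0≡⟦⟧* : ∀ b (x : ℤ) → (if b then x else 0ℤ) ≡ ⟦ b ⟧ * x
if-then-0≡⟦⟧* true  x = sym (ℤ.*-identityˡ x)
if-then-0≡⟦⟧* false x = sym (ℤ.*-zeroˡ x)

δ : ℕ → ℕ → ℤ
δ a i = ⟦ does (a ℕ.≟ i) ⟧

_≟E_ : ∀ {m} (u v : Exp m) → Dec (u ≡ v)
_≟E_ = Vec.≡-dec ℕ._≟_

mono-∷ : ∀ {m} a (u : Exp m) i d → mono (a ∷ u) (i ∷ d) ≡ δ a i * mono u d
mono-∷ a u i d = ⟦∧⟧ (does (a ℕ.≟ i)) (does (u ≟E d))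

mono-no : ∀ {m} {u v : Exp m} → ¬ u ≡ v → mono u v ≡ 0ℤ
mono-no {u = u} {v} p = cong ⟦_⟧ (dec-false (u ≟E v) p)

mono-cong : ∀ {m} {u v : Exp m} → u ≡ v → mono u ≗ mono v
mono-cong refl e = refl

∑<-δ : ∀ k a (H : ℕ → ℤ) → ∑< (suc k) (λ i → δ a i * H i) ≡ (if does (a ℕ.≤? k) then H a else 0ℤ)
∑<-δ k zero H = begin
  ∑< (suc k) (λ i → δ 0 i * H i)          ≡⟨ ∑<-suc k _ ⟩
  1ℤ * H 0 + ∑< k (λ i → 0ℤ * H (suc i))
    ≡⟨ cong₂ _+_ (ℤ.*-identityˡ (H 0)) (trans (∑<-ext k (λ i → ℤ.*-zeroˡ (H (suc i)))) (∑<-zero k)) ⟩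
  H 0 + 0ℤ                                ≡⟨ ℤ.+-identityʳ _ ⟩
  H 0                                     ∎
∑<-δ zero    (suc a) H = ℤ.*-zeroˡ (H 0)
∑<-δ (suc k) (suc a) H = begin
  ∑< (suc (suc k)) (λ i → δ (suc a) i * H i)        ≡⟨ ∑<-suc (suc k) _ ⟩
  0ℤ * H 0 + ∑< (suc k) (λ i → δ a i * H (suc i))   ≡⟨ cong₂ _+_ (ℤ.*-zeroˡ (H 0)) (∑<-δ k a (H ∘ suc)) ⟩
  0ℤ + (if does (a ℕ.≤? k) then H (suc a) else 0ℤ)  ≡⟨ ℤ.+-identityˡ _ ⟩
  (if does (a ℕ.≤? k) then H (suc a) else 0ℤ)       ≡⟨ cong (if_then H (suc a) else 0ℤ) (≤ᵇ-suc a) ⟩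
  (if does (suc a ℕ.≤? suc k) then H (suc a) else 0ℤ) ∎
  where
  ≤ᵇ-suc : ∀ a → (a ℕ.≤ᵇ k) ≡ (suc a ℕ.≤ᵇ suc k)
  ≤ᵇ-suc zero    = refl
  ≤ᵇ-suc (suc a) = refl

∑≤-mono-* : ∀ {m} (u e : Exp m) F →
  ∑≤ e (λ d → mono u d * F d) ≡ (if does (u ≤E? e) then F u else 0ℤ)
∑≤-mono-* []      []      F = trans (ℤ.+-identityʳ _) (ℤ.*-identityˡ (F []))
∑≤-mono-* (a ∷ u) (k ∷ e) F = begin
  ∑≤ (k ∷ e) (λ d → mono (a ∷ u) d * F d)
    ≡⟨ ∑≤-∷ k e _ ⟩
  ∑< (suc k) (λ i → ∑≤ e (λ d → mono (a ∷ u) (i ∷ d) * F (i ∷ d)))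
    ≡⟨ ∑<-ext (suc k) (λ i → ∑≤-ext e (λ d →
         trans (cong (_* F (i ∷ d)) (mono-∷ a u i d)) (ℤ.*-assoc (δ a i) (mono u d) (F (i ∷ d))))) ⟩
  ∑< (suc k) (λ i → ∑≤ e (λ d → δ a i * (mono u d * F (i ∷ d))))
    ≡⟨ ∑<-ext (suc k) (λ i → sym (*-∑≤ e (δ a i) _)) ⟩
  ∑< (suc k) (λ i → δ a i * ∑≤ e (λ d → mono u d * F (i ∷ d)))
    ≡⟨ ∑<-ext (suc k) (λ i → cong (δ a i *_) (∑≤-mono-* u e (λ d → F (i ∷ d)))) ⟩
  ∑< (suc k) (λ i → δ a i * (if does (u ≤E? e) then F (i ∷ u) else 0ℤ))
    ≡⟨ ∑<-δ k a _ ⟩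
  (if does (a ℕ.≤? k) then (if does (u ≤E? e) then F (a ∷ u) else 0ℤ) else 0ℤ)
    ≡⟨ nested-if (does (a ℕ.≤? k)) (does (u ≤E? e)) ⟩
  (if does ((a ∷ u) ≤E? (k ∷ e)) then F (a ∷ u) else 0ℤ) ∎
  where
  nested-if : ∀ x y → (if x then (if y then F (a ∷ u) else 0ℤ) else 0ℤ) ≡ (if x ∧ y then F (a ∷ u) else 0ℤ)
  nested-if true  y = refl
  nested-if false y = refl

∸E-∸E : ∀ {m} {d e : Exp m} → d ≤E e → e ∸E (e ∸E d) ≡ d
∸E-∸E []         = refl
∸E-∸E (p ∷ d≤e) = cong₂ _∷_ (ℕ.m∸[m∸n]≡n p) (∸E-∸E d≤e)

+E-∸E : ∀ {m} {u e : Exp m} → u ≤E e → u +E (e ∸E u) ≡ e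
+E-∸E []         = refl
+E-∸E (p ∷ u≤e) = cong₂ _∷_ (ℕ.m+[n∸m]≡n p) (+E-∸E u≤e)

+∸E : ∀ {m} (d d' : Exp m) → (d +E d') ∸E d ≡ d'
+∸E []      []        = refl
+∸E (a ∷ d) (b ∷ d') = cong₂ _∷_ (ℕ.m+n∸m≡n a b) (+∸E d d')

∸E-+ : ∀ {m} (e d d' : Exp m) → e ∸E (d +E d') ≡ (e ∸E d) ∸E d'
∸E-+ []      []      []        = refl
∸E-+ (c ∷ e) (a ∷ d) (b ∷ d') = cong₂ _∷_ (sym (ℕ.∸-+-assoc c a b)) (∸E-+ e d d')

∸E-zero : ∀ {m} (e : Exp m) → e ∸E zeroE ≡ e
∸E-zero []      = refl
∸E-zero (a ∷ e) = cong (a ∷_) (∸E-zero e)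

∸E-self : ∀ {m} (s : Exp m) → s ∸E s ≡ zeroE
∸E-self []      = refl
∸E-self (a ∷ s) = cong₂ _∷_ (ℕ.n∸n≡0 a) (∸E-self s)

zero+E : ∀ {m} (v : Exp m) → zeroE +E v ≡ v
zero+E []      = refl
zero+E (a ∷ v) = cong (a ∷_) (zero+E v)

+E-zero : ∀ {m} (s : Exp m) → s +E zeroE ≡ s
+E-zero []      = refl
+E-zero (a ∷ s) = cong₂ _∷_ (ℕ.+-identityʳ a) (+E-zero s)

∸E-≤E : ∀ {m} (u v : Exp m) → (u ∸E v) ≤E u
∸E-≤E []      []      = []
∸E-≤E (a ∷ u) (b ∷ v) = ℕ.m∸n≤m a b ∷ ∸E-≤E u v

≤E-+E : ∀ {m} (u v : Exp m) → u ≤E (u +E v)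
≤E-+E []      []      = []
≤E-+E (a ∷ u) (b ∷ v) = ℕ.m≤m+n a b ∷ ≤E-+E u v

zeroE≤E : ∀ {m} (e : Exp m) → zeroE ≤E e
zeroE≤E []      = []
zeroE≤E (a ∷ e) = z≤n ∷ zeroE≤E e

≤E-refl : ∀ {m} (u : Exp m) → u ≤E u
≤E-refl u = Pointwise.refl ℕ.≤-refl

infixl 6 _+P_

_+P_ : ∀ {m} → PS m → PS m → PS m
(a +P b) e = a e + b e

negP : ∀ {m} → PS m → PS m
negP a e = - a e

0P : ∀ {m} → PS m
0P e = 0ℤ

constP : ∀ {m} → ℤ → PS m
constP c e = c * oneP e

*P-cong : ∀ {m} {a a' b b' : PS m} → a ≗ a' → b ≗ b' → (a *P b) ≗ (a' *P b')
*P-cong p q e = ∑≤-ext e (λ d → cong₂ _*_ (p d) (q (e ∸E d)))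

*P-congˡ : ∀ {m} (a : PS m) {b b' : PS m} → b ≗ b' → (a *P b) ≗ (a *P b')
*P-congˡ a = *P-cong {a = a} (λ _ → refl)

*P-comm : ∀ {m} (a b : PS m) → (a *P b) ≗ (b *P a)
*P-comm a b e = begin
  ∑≤ e (λ d → a d * b (e ∸E d))                ≡⟨ ∑≤-reverse e _ ⟩
  ∑≤ e (λ d → a (e ∸E d) * b (e ∸E (e ∸E d)))
    ≡⟨ ∑≤-cong e (λ d d≤e → trans (cong (λ x → a (e ∸E d) * b x) (∸E-∸E d≤e)) (ℤ.*-comm (a (e ∸E d)) (b d))) ⟩
  ∑≤ e (λ d → b d * a (e ∸E d))                ∎

*P-assoc : ∀ {m} (a b c : PS m) → ((a *P b) *P c) ≗ (a *P (b *P c))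
*P-assoc a b c e = begin
  ∑≤ e (λ d → ∑≤ d (λ d' → a d' * b (d ∸E d')) * c (e ∸E d))
    ≡⟨ ∑≤-ext e (λ d → trans (ℤ.*-comm (∑≤ d (λ d' → a d' * b (d ∸E d'))) (c (e ∸E d)))
          (trans (*-∑≤ d (c (e ∸E d)) _) (∑≤-ext d (λ d' → ℤ.*-comm (c (e ∸E d)) _)))) ⟩
  ∑≤ e (λ d → ∑≤ d (λ d' → (a d' * b (d ∸E d')) * c (e ∸E d)))
    ≡⟨ ∑≤-triangle e (λ d' d → (a d' * b (d ∸E d')) * c (e ∸E d)) ⟩
  ∑≤ e (λ d' → ∑≤ (e ∸E d') (λ d'' → (a d' * b ((d' +E d'') ∸E d')) * c (e ∸E (d' +E d''))))
    ≡⟨ ∑≤-ext e (λ d' → ∑≤-ext (e ∸E d') (λ d'' →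
         trans (cong₂ (λ x y → (a d' * b x) * c y) (+∸E d' d'') (∸E-+ e d' d''))
               (ℤ.*-assoc (a d') _ _))) ⟩
  ∑≤ e (λ d' → ∑≤ (e ∸E d') (λ d'' → a d' * (b d'' * c ((e ∸E d') ∸E d''))))
    ≡⟨ ∑≤-ext e (λ d' → sym (*-∑≤ (e ∸E d') (a d') _)) ⟩
  ∑≤ e (λ d' → a d' * ∑≤ (e ∸E d') (λ d'' → b d'' * c ((e ∸E d') ∸E d''))) ∎

∑≤-oneP-* : ∀ {m} (F : Exp m → ℤ) e → ∑≤ e (λ d → oneP d * F d) ≡ F zeroE
∑≤-oneP-* F e = trans (∑≤-mono-* zeroE e F)
  (cong (if_then F zeroE else 0ℤ) (dec-true (zeroE ≤E? e) (zeroE≤E e)))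

*P-identityˡ : ∀ {m} (a : PS m) → (oneP *P a) ≗ a
*P-identityˡ a e = trans (∑≤-oneP-* (λ d → a (e ∸E d)) e) (cong a (∸E-zero e))

*P-identityʳ : ∀ {m} (a : PS m) → (a *P oneP) ≗ a
*P-identityʳ a e = trans (*P-comm a oneP e) (*P-identityˡ a e)

*P-distribˡ : ∀ {m} (a b c : PS m) → (a *P (b +P c)) ≗ ((a *P b) +P (a *P c))
*P-distribˡ a b c e = trans (∑≤-ext e (λ d → ℤ.*-distribˡ-+ (a d) _ _)) (∑≤-+ e _ _)

*P-distribʳ : ∀ {m} (a b c : PS m) → ((b +P c) *P a) ≗ ((b *P a) +P (c *P a))
*P-distribʳ a b c e = trans (*P-comm (b +P c) a e)
  (trans (*P-distribˡ a b c e) (cong₂ _+_ (*P-comm a b e) (*P-comm a c e)))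

constP-1 : ∀ {m} → constP {m} 1ℤ ≗ oneP
constP-1 e = ℤ.*-identityˡ (oneP e)

constP-* : ∀ {m} x y → constP {m} (x * y) ≗ (constP x *P constP y)
constP-* x y e = sym (begin
  ∑≤ e (λ d → (x * oneP d) * (y * oneP (e ∸E d)))
    ≡⟨ ∑≤-ext e (λ d → trans (cong (_* (y * oneP (e ∸E d))) (ℤ.*-comm x (oneP d))) (ℤ.*-assoc (oneP d) x _)) ⟩
  ∑≤ e (λ d → oneP d * (x * (y * oneP (e ∸E d)))) ≡⟨ ∑≤-oneP-* (λ d → x * (y * oneP (e ∸E d))) e ⟩
  x * (y * oneP (e ∸E zeroE))                      ≡⟨ cong (λ v → x * (y * oneP v)) (∸E-zero e) ⟩
  x * (y * oneP e)                                 ≡⟨ sym (ℤ.*-assoc x y _) ⟩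
  (x * y) * oneP e                                 ∎)

module PowerSeriesRing (m : ℕ) where

  open import Algebra.Bundles using (CommutativeRing)
  open import Algebra.Structures using (IsCommutativeRing)
  open import Algebra.Solver.Ring.AlmostCommutativeRing
    using (AlmostCommutativeRing; fromCommutativeRing; _-Raw-AlmostCommutative⟶_)
  open import Data.Maybe using (Maybe; just; nothing)

  isCommutativeRing : IsCommutativeRing (_≗_ {A = Exp m} {B = ℤ}) _+P_ _*P_ negP 0P oneP
  isCommutativeRing = record
    { isRing = record
      { +-isAbelianGroup = record
        { isGroup = record
          { isMonoid = record
            { isSemigroup = record
              { isMagma = record
                { isEquivalence = record
                  { refl = λ _ → refl ; sym = λ p e → sym (p e) ; trans = λ p q e → trans (p e) (q e) }
                ; ∙-cong = λ p q e → cong₂ _+_ (p e) (q e) }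
              ; assoc = λ a b c e → ℤ.+-assoc (a e) (b e) (c e) }
            ; identity = (λ a e → ℤ.+-identityˡ (a e)) , (λ a e → ℤ.+-identityʳ (a e)) }
          ; inverse = (λ a e → ℤ.+-inverseˡ (a e)) , (λ a e → ℤ.+-inverseʳ (a e))
          ; ⁻¹-cong = λ p e → cong -_ (p e) }
        ; comm = λ a b e → ℤ.+-comm (a e) (b e) }
      ; *-cong   = *P-cong
      ; *-assoc  = *P-assoc
      ; *-identity = *P-identityˡ , *P-identityʳ
      ; distrib  = *P-distribˡ , *P-distribʳ }
    ; *-comm = *P-comm }

  commutativeRing : CommutativeRing _ _
  commutativeRing = record { isCommutativeRing = isCommutativeRing }

  private
    almostCommutativeRing : AlmostCommutativeRing _ _
    almostCommutativeRing = fromCommutativeRing commutativeRing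

    constP-homo : ℤ.+-*-rawRing -Raw-AlmostCommutative⟶ almostCommutativeRing
    constP-homo = record
      { ⟦_⟧    = constP
      ; +-homo = λ x y e → ℤ.*-distribʳ-+ (oneP e) x y
      ; *-homo = constP-*
      ; -‿homo = λ x e → sym (ℤ.neg-distribˡ-* x (oneP e))
      ; 0-homo = λ e → ℤ.*-zeroˡ (oneP e)
      ; 1-homo = λ e → ℤ.*-identityˡ (oneP e) }

    constP-≟ : ∀ x y → Maybe (constP {m} x ≗ constP y)
    constP-≟ x y with x ℤ.≟ y
    ... | yes p = just (λ e → cong (λ c → c * oneP e) p)
    ... | no _  = nothing

  open import Algebra.Solver.Ring ℤ.+-*-rawRing almostCommutativeRing constP-homo constP-≟ public

mono-*ˡ : ∀ {m} (u : Exp m) P e → (mono u *P P) e ≡ (if does (u ≤E? e) then P (e ∸E u) else 0ℤ)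
mono-*ˡ u P e = ∑≤-mono-* u e (λ d → P (e ∸E d))

mono-*ʳ : ∀ {m} (u : Exp m) P e → (P *P mono u) e ≡ (if does (u ≤E? e) then P (e ∸E u) else 0ℤ)
mono-*ʳ u P e = trans (*P-comm P (mono u) e) (mono-*ˡ u P e)

mono-*ʳ-≰ : ∀ {m} (u : Exp m) P e → ¬ u ≤E e → (P *P mono u) e ≡ 0ℤ
mono-*ʳ-≰ u P e u≰e = trans (mono-*ʳ u P e) (cong (if_then P (e ∸E u) else 0ℤ) (dec-false (u ≤E? e) u≰e))

mono-∸E : ∀ {m} {u e : Exp m} (v : Exp m) → u ≤E e → mono v (e ∸E u) ≡ mono (u +E v) e
mono-∸E {u = u} {e} v u≤e with v ≟E (e ∸E u) | (u +E v) ≟E e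
... | yes _ | yes _ = refl
... | no  _ | no  _ = refl
... | yes p | no ¬q = ⊥-elim (¬q (trans (cong (u +E_) p) (+E-∸E u≤e)))
... | no ¬p | yes q = ⊥-elim (¬p (trans (sym (+∸E u v)) (cong (_∸E u) q)))

mono-*P-mono : ∀ {m} (u v : Exp m) → (mono u *P mono v) ≗ mono (u +E v)
mono-*P-mono u v e with u ≤E? e | mono-*ˡ u (mono v) e
... | yes u≤e | eq = trans eq (mono-∸E v u≤e)
... | no  u≰e | eq = trans eq (sym (mono-no (λ p → u≰e (subst (u ≤E_) p (≤E-+E u v)))))

tdeg-mono-≤ : ∀ {m} {u v : Exp m} → u ≤E v → totalDeg u ≤ totalDeg v
tdeg-mono-≤ []       = z≤n
tdeg-mono-≤ (p ∷ q) = ℕ.+-mono-≤ p (tdeg-mono-≤ q)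

tdeg-scaleE : ∀ {m} k (d : Exp m) → totalDeg (scaleE k d) ≡ k ℕ.* totalDeg d
tdeg-scaleE k []      = sym (ℕ.*-zeroʳ k)
tdeg-scaleE k (a ∷ d) = trans (cong (k ℕ.* a ℕ.+_) (tdeg-scaleE k d)) (sym (ℕ.*-distribˡ-+ k a (totalDeg d)))

≤-tdeg-scaleE : ∀ {m} k (d : Exp m) → 1 ≤ totalDeg d → k ≤ totalDeg (scaleE k d)
≤-tdeg-scaleE k d d≥1 = subst (k ≤_) (sym (tdeg-scaleE k d))
  (subst (_≤ k ℕ.* totalDeg d) (ℕ.*-identityʳ k) (ℕ.*-monoʳ-≤ k d≥1))

lookup≤tdeg : ∀ {m} (u : Exp m) i → lookup u i ≤ totalDeg u
lookup≤tdeg (a ∷ u) Fin.zero    = ℕ.m≤m+n a (totalDeg u)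
lookup≤tdeg (a ∷ u) (Fin.suc i) = ℕ.≤-trans (lookup≤tdeg u i) (ℕ.m≤n+m (totalDeg u) a)

tdeg-∷∷ : ∀ {m} a b (v : Exp m) → totalDeg v ≤ totalDeg (a ∷ b ∷ v)
tdeg-∷∷ a b v = ℕ.≤-trans (ℕ.m≤n+m (totalDeg v) b) (ℕ.m≤n+m (b ℕ.+ totalDeg v) a)

scaleE-zero : ∀ {m} (d : Exp m) → scaleE 0 d ≡ zeroE
scaleE-zero []      = refl
scaleE-zero (a ∷ d) = cong (0 ∷_) (scaleE-zero d)

scaleE-suc : ∀ {m} k (d : Exp m) → scaleE (suc k) d ≡ d +E scaleE k d
scaleE-suc k []      = refl
scaleE-suc k (a ∷ d) = cong (a ℕ.+ k ℕ.* a ∷_) (scaleE-suc k d)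

scaleE-zeroE : ∀ {m} k → scaleE k (zeroE {m}) ≡ zeroE
scaleE-zeroE {zero}  k = refl
scaleE-zeroE {suc m} k = cong₂ _∷_ (ℕ.*-zeroʳ k) (scaleE-zeroE k)

mono-scaleE-vanishes : ∀ {m} (d e : Exp m) → 1 ≤ totalDeg d → ∀ k → totalDeg e < k → mono (scaleE k d) e ≡ 0ℤ
mono-scaleE-vanishes d e d≥1 k e<k =
  mono-no {u = scaleE k d} {v = e} (λ kd≡e → ℕ.<⇒≱ e<k (subst (λ u → k ≤ totalDeg u) kd≡e (≤-tdeg-scaleE k d d≥1)))

geomP-≡-∑< : ∀ {m} (d e : Exp m) → 1 ≤ totalDeg d → ∀ K → totalDeg e < K →
  geomP d e ≡ ∑< K (λ k → mono (scaleE k d) e)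
geomP-≡-∑< d e d≥1 K e<K = trans (sumℤ-map-upTo _ (suc (totalDeg e)))
  (sym (∑<-vanishing-tail (suc (totalDeg e)) K _ (mono-scaleE-vanishes d e d≥1) e<K))

*P-oneP-minus : ∀ {m} (G M : PS m) → (G *P (oneP -P M)) ≗ (G -P (M *P G))
*P-oneP-minus G M e = begin
  ∑≤ e (λ d → G d * (oneP (e ∸E d) + - M (e ∸E d))) ≡⟨ *P-distribˡ G oneP (negP M) e ⟩
  (G *P oneP) e + (G *P negP M) e
    ≡⟨ cong₂ _+_ (*P-identityʳ G e)
                 (trans (∑≤-ext e (λ d → sym (ℤ.neg-distribʳ-* (G d) _))) (sym (neg-∑≤ e _))) ⟩
  G e - (G *P M) e                                   ≡⟨ cong (λ x → G e - x) (*P-comm G M e) ⟩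
  G e - (M *P G) e                                   ∎

oneP-minus-*P : ∀ {m} (M G : PS m) → ((oneP -P M) *P G) ≗ (G -P (M *P G))
oneP-minus-*P M G e = trans (*P-comm (oneP -P M) G e) (*P-oneP-minus G M e)

geomP-inverse : ∀ {m} (d : Exp m) → 1 ≤ totalDeg d → (geomP d *P (oneP -P mono d)) ≗ oneP
geomP-inverse d d≥1 e = begin
  (geomP d *P (oneP -P mono d)) e                                ≡⟨ *P-oneP-minus (geomP d) (mono d) e ⟩
  geomP d e - (mono d *P geomP d) e                              ≡⟨ cong (λ x → geomP d e - x) (mono-*ˡ d (geomP d) e) ⟩
  geomP d e - (if does (d ≤E? e) then geomP d (e ∸E d) else 0ℤ) ≡⟨ telescope (d ≤E? e) ⟩
  f 0                                                            ≡⟨ mono-cong (scaleE-zero d) e ⟩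
  oneP e                                                         ∎
  where
  K : ℕ
  K = totalDeg e
  f : ℕ → ℤ
  f k = mono (scaleE k d) e
  geomP-e : geomP d e ≡ f 0 + ∑< K (f ∘ suc)
  geomP-e = trans (geomP-≡-∑< d e d≥1 (suc K) ℕ.≤-refl) (∑<-suc K f)
  cancel : ∀ a x → (a + x) - (x + 0ℤ) ≡ a
  cancel = ℤ-solve-∀
  telescope : (d≤e? : Dec (d ≤E e)) → geomP d e - (if does d≤e? then geomP d (e ∸E d) else 0ℤ) ≡ f 0
  telescope (yes d≤e) = begin
    geomP d e - geomP d (e ∸E d)
      ≡⟨ cong₂ _-_ geomP-e (geomP-≡-∑< d (e ∸E d) d≥1 (suc K) (s≤s (tdeg-mono-≤ (∸E-≤E e d)))) ⟩
    (f 0 + ∑< K (f ∘ suc)) - ∑< (suc K) (λ k → mono (scaleE k d) (e ∸E d))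
      ≡⟨ cong (λ x → (f 0 + ∑< K (f ∘ suc)) - x)
           (∑<-ext (suc K) (λ k → trans (mono-∸E (scaleE k d) d≤e) (mono-cong (sym (scaleE-suc k d)) e))) ⟩
    (f 0 + ∑< K (f ∘ suc)) - (∑< K (f ∘ suc) + f (suc K))
      ≡⟨ cong (λ x → (f 0 + ∑< K (f ∘ suc)) - (∑< K (f ∘ suc) + x))
           (mono-scaleE-vanishes d e d≥1 (suc K) ℕ.≤-refl) ⟩
    (f 0 + ∑< K (f ∘ suc)) - (∑< K (f ∘ suc) + 0ℤ)
      ≡⟨ cancel (f 0) (∑< K (f ∘ suc)) ⟩
    f 0 ∎
  telescope (no d≰e) = begin
    geomP d e - 0ℤ          ≡⟨ ℤ.+-identityʳ _ ⟩
    geomP d e               ≡⟨ geomP-e ⟩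
    f 0 + ∑< K (f ∘ suc)    ≡⟨ cong (f 0 +_) (trans (∑<-ext K f-suc≡0) (∑<-zero K)) ⟩
    f 0 + 0ℤ                ≡⟨ ℤ.+-identityʳ _ ⟩
    f 0                     ∎
    where
    f-suc≡0 : ∀ k → f (suc k) ≡ 0ℤ
    f-suc≡0 k = mono-no (λ p → d≰e (subst (d ≤E_) (trans (sym (scaleE-suc k d)) p) (≤E-+E d (scaleE k d))))

prodP-applyUpTo-suc : ∀ {m} (f : ℕ → PS m) g k →
  prodP (List.map f (applyUpTo g (suc k))) ≗ (prodP (List.map f (applyUpTo g k)) *P f (g k))
prodP-applyUpTo-suc f g zero    e = *P-comm (f (g 0)) oneP e
prodP-applyUpTo-suc f g (suc k) e = begin
  (f (g 0) *P prodP (List.map f (applyUpTo (g ∘ suc) (suc k)))) e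
    ≡⟨ *P-congˡ (f (g 0)) (prodP-applyUpTo-suc f (g ∘ suc) k) e ⟩
  (f (g 0) *P (prodP (List.map f (applyUpTo (g ∘ suc) k)) *P f (g (suc k)))) e
    ≡⟨ sym (*P-assoc (f (g 0)) (prodP (List.map f (applyUpTo (g ∘ suc) k))) (f (g (suc k))) e) ⟩
  ((f (g 0) *P prodP (List.map f (applyUpTo (g ∘ suc) k))) *P f (g (suc k))) e ∎

module _ {N : ℕ} where
  open PowerSeriesRing (Var N)

  oneP-minus≗constP : (Q : PS (Var N)) → (oneP -P Q) ≗ (constP 1ℤ -P Q)
  oneP-minus≗constP Q d = cong (_- Q d) (sym (constP-1 d))

  fqt-suc : ∀ k → (fqt {N} (suc k) *P (oneP -P mono (suc k ∷ 0 ∷ zeroE)))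
                ≗ (fqt k *P (oneP -P mono (k ∷ 1 ∷ zeroE)))
  fqt-suc k e = begin
    (fqt (suc k) *P (oneP -P Q)) e
      ≡⟨ *P-cong (*P-cong (prodP-applyUpTo-suc tFactor id k) (prodP-applyUpTo-suc qFactor id k))
                 (oneP-minus≗constP Q) e ⟩
    (((tqPoch k *P tFactor k) *P (invqqPoch k *P qFactor k)) *P (constP 1ℤ -P Q)) e
      ≡⟨ solve 5 (λ tq a iq g Q → ((tq :* a) :* (iq :* g)) :* (con 1ℤ :- Q) := (tq :* iq) :* a :* (g :* (con 1ℤ :- Q)))
           (λ _ → refl) (tqPoch k) (tFactor k) (invqqPoch k) (qFactor k) Q e ⟩
    ((fqt k *P tFactor k) *P (qFactor k *P (constP 1ℤ -P Q))) e
      ≡⟨ *P-congˡ (fqt k *P tFactor k) (λ d → trans (*P-congˡ (qFactor k) (λ d' → sym (oneP-minus≗constP Q d')) d)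
                                                    (geomP-inverse (suc k ∷ 0 ∷ zeroE) (s≤s z≤n) d)) e ⟩
    ((fqt k *P tFactor k) *P oneP) e
      ≡⟨ *P-identityʳ (fqt k *P tFactor k) e ⟩
    (fqt k *P (oneP -P mono (k ∷ 1 ∷ zeroE))) e ∎
    where
    Q : PS (Var N)
    Q = mono (suc k ∷ 0 ∷ zeroE)
    tFactor qFactor : ℕ → PS (Var N)
    tFactor i = oneP -P mono (i ∷ 1 ∷ zeroE)
    qFactor i = geomP (suc i ∷ 0 ∷ zeroE)

  fqt-suc-difference : ∀ k → (fqt {N} (suc k) -P fqt k)
                           ≗ ((fqt (suc k) *P mono (suc k ∷ 0 ∷ zeroE)) -P (fqt k *P mono (k ∷ 1 ∷ zeroE)))
  fqt-suc-difference k e = begin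
    (F1 -P F0) e
      ≡⟨ solve 4 (λ F1 F0 Q Tq → F1 :- F0 := F1 :* (con 1ℤ :- Q) :- F0 :* (con 1ℤ :- Tq) :+ (F1 :* Q :- F0 :* Tq))
           (λ _ → refl) F1 F0 Q Tq e ⟩
    ((F1 *P (constP 1ℤ -P Q)) e - (F0 *P (constP 1ℤ -P Tq)) e) + ((F1 *P Q) -P (F0 *P Tq)) e
      ≡⟨ cong (λ x → (x - (F0 *P (constP 1ℤ -P Tq)) e) + ((F1 *P Q) -P (F0 *P Tq)) e) fqt-suc′ ⟩
    ((F0 *P (constP 1ℤ -P Tq)) e - (F0 *P (constP 1ℤ -P Tq)) e) + ((F1 *P Q) -P (F0 *P Tq)) e
      ≡⟨ cong (_+ ((F1 *P Q) -P (F0 *P Tq)) e) (ℤ.+-inverseʳ ((F0 *P (constP 1ℤ -P Tq)) e)) ⟩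
    0ℤ + ((F1 *P Q) -P (F0 *P Tq)) e
      ≡⟨ ℤ.+-identityˡ _ ⟩
    ((F1 *P Q) -P (F0 *P Tq)) e ∎
    where
    F1 F0 Q Tq : PS (Var N)
    F1 = fqt (suc k)
    F0 = fqt k
    Q  = mono (suc k ∷ 0 ∷ zeroE)
    Tq = mono (k ∷ 1 ∷ zeroE)
    fqt-suc′ : (F1 *P (constP 1ℤ -P Q)) e ≡ (F0 *P (constP 1ℤ -P Tq)) e
    fqt-suc′ = begin
      (F1 *P (constP 1ℤ -P Q)) e  ≡⟨ *P-congˡ F1 (λ d → sym (oneP-minus≗constP Q d)) e ⟩
      (F1 *P (oneP -P Q)) e       ≡⟨ fqt-suc k e ⟩
      (F0 *P (oneP -P Tq)) e      ≡⟨ *P-congˡ F0 (oneP-minus≗constP Tq) e ⟩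
      (F0 *P (constP 1ℤ -P Tq)) e ∎

∑ₚ : ∀ {m} → ℕ → (ℕ → PS m) → PS m
∑ₚ K F e = ∑< K (λ k → F k e)

*P-∑ₚ : ∀ {m} (P : PS m) K F → (P *P ∑ₚ K F) ≗ ∑ₚ K (λ k → P *P F k)
*P-∑ₚ P K F e = begin
  ∑≤ e (λ d → P d * ∑< K (λ k → F k (e ∸E d))) ≡⟨ ∑≤-ext e (λ d → *-∑< K (P d) _) ⟩
  ∑≤ e (λ d → ∑< K (λ k → P d * F k (e ∸E d))) ≡⟨ sym (∑<-∑≤-comm K e (λ k d → P d * F k (e ∸E d))) ⟩
  ∑< K (λ k → ∑≤ e (λ d → P d * F k (e ∸E d))) ∎

∑ₚ-*P : ∀ {m} (P : PS m) K F → (∑ₚ K F *P P) ≗ ∑ₚ K (λ k → F k *P P)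
∑ₚ-*P P K F e = trans (*P-comm (∑ₚ K F) P e) (trans (*P-∑ₚ P K F e) (∑<-ext K (λ k → *P-comm P (F k) e)))

AgreeBelow : ∀ {m} → ℕ → PS m → PS m → Set
AgreeBelow K A B = ∀ d → totalDeg d < K → A d ≡ B d

*P-agreeBelow : ∀ {m} {K} {A A' C C' : PS m} →
  AgreeBelow K A A' → AgreeBelow K C C' → AgreeBelow K (A *P C) (A' *P C')
*P-agreeBelow p q d d<K = ∑≤-cong d (λ d' d'≤d → cong₂ _*_
  (p d' (ℕ.≤-<-trans (tdeg-mono-≤ d'≤d) d<K))
  (q (d ∸E d') (ℕ.≤-<-trans (tdeg-mono-≤ (∸E-≤E d d')) d<K)))

*P-agreeBelowˡ : ∀ {m} {K} (C : PS m) {A A' : PS m} → AgreeBelow K A A' → AgreeBelow K (C *P A) (C *P A')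
*P-agreeBelowˡ C = *P-agreeBelow {A = C} (λ _ _ → refl)

prodP-agreeBelow : ∀ {m} {K} {X : Set} (f f' : X → PS m) → (∀ x → AgreeBelow K (f x) (f' x)) →
  ∀ xs → AgreeBelow K (prodP (List.map f xs)) (prodP (List.map f' xs))
prodP-agreeBelow f f' p []       d _ = refl
prodP-agreeBelow f f' p (x ∷ xs)     = *P-agreeBelow (p x) (prodP-agreeBelow f f' p xs)

qdeg-mono-≤ : ∀ {N} {u v : Exp (Var N)} → u ≤E v → qdeg u ≤ qdeg v
qdeg-mono-≤ (p ∷ _ ∷ _) = p

mono-*P-*P-mono : ∀ {m} (u v : Exp m) F → (mono u *P (F *P mono v)) ≗ (F *P mono (u +E v))
mono-*P-*P-mono {m} u v F e = begin
  (mono u *P (F *P mono v)) e ≡⟨ solve 3 (λ X F Y → X :* (F :* Y) := F :* (X :* Y)) (λ _ → refl) (mono u) F (mono v) e ⟩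
  (F *P (mono u *P mono v)) e ≡⟨ *P-congˡ F (mono-*P-mono u v) e ⟩
  (F *P mono (u +E v)) e      ∎
  where open PowerSeriesRing m

oneP-minus-*P-∑ₚ : ∀ {m} K (u : Exp m) (T S : ℕ → PS m) → (∀ k → (mono u *P T k) ≗ S k) →
  ((oneP -P mono u) *P ∑ₚ K T) ≗ (∑ₚ K T -P ∑ₚ K S)
oneP-minus-*P-∑ₚ K u T S uT≗S e = trans (oneP-minus-*P (mono u) (∑ₚ K T) e)
  (cong (λ x → ∑ₚ K T e - x) (trans (*P-∑ₚ (mono u) K T e) (∑<-ext K (λ k → uT≗S k e))))

∑ₚ-minus-∑ₚ : ∀ {m} K' (T S : ℕ → PS m) d → S K' d ≡ 0ℤ →
  (∑ₚ (suc K') T -P ∑ₚ (suc K') S) d ≡ T 0 d + ∑< K' (λ k → T (suc k) d - S k d)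
∑ₚ-minus-∑ₚ K' T S d S-last≡0 = begin
  ∑ₚ (suc K') T d - (∑< K' (λ k → S k d) + S K' d)
    ≡⟨ cong₂ (λ x y → x - (∑< K' (λ k → S k d) + y)) (∑<-suc K' (λ k → T k d)) S-last≡0 ⟩
  (T 0 d + ∑< K' (λ k → T (suc k) d)) - (∑< K' (λ k → S k d) + 0ℤ)
    ≡⟨ regroup (T 0 d) (∑< K' (λ k → T (suc k) d)) (∑< K' (λ k → S k d)) ⟩
  T 0 d + (∑< K' (λ k → T (suc k) d) + - ∑< K' (λ k → S k d))
    ≡⟨ cong (λ x → T 0 d + (∑< K' (λ k → T (suc k) d) + x)) (neg-∑< K' (λ k → S k d)) ⟩
  T 0 d + (∑< K' (λ k → T (suc k) d) + ∑< K' (λ k → - S k d))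
    ≡⟨ cong (T 0 d +_) (sym (∑<-+ K' _ _)) ⟩
  T 0 d + ∑< K' (λ k → T (suc k) d - S k d) ∎
  where
  regroup : ∀ a x y → (a + x) - (y + 0ℤ) ≡ a + (x + - y)
  regroup = ℤ-solve-∀

-- The q-binomial theorem F(x) = Σ_k f(k) x^k for x = z^h, up to total degree K.
-- With G j = Σ_k f(k) (q^j x)^k the recursion f(k+1)(1 - q^(k+1)) = f(k)(1 - t q^k)
-- gives (1 - q^j x) G j = (1 - t q^j x) G (j+1); iterating, G 0 = Π_{i<M} g i · G M,
-- and G M ≡ 1 modulo q^M.
module QBinomial {N : ℕ} (h : Exp N) (h≥1 : 1 ≤ totalDeg h) (K' : ℕ) where
  open PowerSeriesRing (Var N)

  K : ℕ
  K = suc K'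

  term : ℕ → ℕ → PS (Var N)
  term j k = fqt k *P mono (j ℕ.* k ∷ 0 ∷ scaleE k h)

  G : ℕ → PS (Var N)
  G j = ∑ₚ K (term j)

  g : ℕ → PS (Var N)
  g i = (oneP -P mono (i ∷ 1 ∷ h)) *P geomP (i ∷ 0 ∷ h)

  qShifted tShifted : ℕ → ℕ → PS (Var N)
  qShifted j k = fqt k *P mono (j ℕ.* suc k ∷ 0 ∷ scaleE (suc k) h)
  tShifted j k = fqt k *P mono (j ℕ.+ suc j ℕ.* k ∷ 1 ∷ scaleE (suc k) h)

  mono-*P-term : ∀ j k → (mono (j ∷ 0 ∷ h) *P term j k) ≗ qShifted j k
  mono-*P-term j k e = trans (mono-*P-*P-mono (j ∷ 0 ∷ h) (j ℕ.* k ∷ 0 ∷ scaleE k h) (fqt k) e)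
    (*P-congˡ (fqt k) (mono-cong (cong₂ _∷_ (sym (ℕ.*-suc j k)) (cong (0 ∷_) (sym (scaleE-suc k h))))) e)

  tmono-*P-term : ∀ j k → (mono (j ∷ 1 ∷ h) *P term (suc j) k) ≗ tShifted j k
  tmono-*P-term j k e = trans (mono-*P-*P-mono (j ∷ 1 ∷ h) (suc j ℕ.* k ∷ 0 ∷ scaleE k h) (fqt k) e)
    (*P-congˡ (fqt k) (mono-cong (cong (λ x → j ℕ.+ suc j ℕ.* k ∷ 1 ∷ x) (sym (scaleE-suc k h)))) e)

  *P-mono-K-vanishes : ∀ (F : PS (Var N)) a b d → totalDeg d < K → (F *P mono (a ∷ b ∷ scaleE K h)) d ≡ 0ℤ
  *P-mono-K-vanishes F a b d d<K = mono-*ʳ-≰ _ F d (λ u≤d → ℕ.<⇒≱ d<K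
    (ℕ.≤-trans (ℕ.≤-trans (≤-tdeg-scaleE K h h≥1) (tdeg-∷∷ a b (scaleE K h))) (tdeg-mono-≤ u≤d)))

  term-zero : ∀ j → term j 0 ≗ term (suc j) 0
  term-zero j = *P-congˡ (fqt 0)
    (mono-cong (cong (λ x → x ∷ 0 ∷ scaleE 0 h) (trans (ℕ.*-zeroʳ j) (sym (ℕ.*-zeroʳ (suc j))))))

  term-suc : ∀ j k → (term j (suc k) -P qShifted j k) ≗ (term (suc j) (suc k) -P tShifted j k)
  term-suc j k e = begin
    ((F1 *P Y) -P (F0 *P Y)) e            ≡⟨ solve 3 (λ F1 F0 Y → F1 :* Y :- F0 :* Y := (F1 :- F0) :* Y) (λ _ → refl) F1 F0 Y e ⟩
    ((F1 -P F0) *P Y) e                   ≡⟨ *P-cong {b = Y} (fqt-suc-difference k) (λ _ → refl) e ⟩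
    (((F1 *P Q1) -P (F0 *P Tq)) *P Y) e
      ≡⟨ solve 5 (λ F1 F0 Q1 Tq Y → (F1 :* Q1 :- F0 :* Tq) :* Y := F1 :* (Q1 :* Y) :- F0 :* (Tq :* Y))
           (λ _ → refl) F1 F0 Q1 Tq Y e ⟩
    ((F1 *P (Q1 *P Y)) -P (F0 *P (Tq *P Y))) e
      ≡⟨ cong₂ _-_ (*P-congˡ F1 (λ d → trans (mono-*P-mono (suc k ∷ 0 ∷ zeroE) y d) (mono-cong (Q1Y j k) d)) e)
                   (*P-congˡ F0 (λ d → trans (mono-*P-mono (k ∷ 1 ∷ zeroE) y d) (mono-cong (TqY j k) d)) e) ⟩
    (term (suc j) (suc k) -P tShifted j k) e ∎
    where
    y : Exp (Var N)
    y = j ℕ.* suc k ∷ 0 ∷ scaleE (suc k) h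
    F1 F0 Y Q1 Tq : PS (Var N)
    F1 = fqt (suc k)
    F0 = fqt k
    Y  = mono y
    Q1 = mono (suc k ∷ 0 ∷ zeroE)
    Tq = mono (k ∷ 1 ∷ zeroE)
    Q1Y : ∀ j k → (suc k ∷ 0 ∷ zeroE) +E (j ℕ.* suc k ∷ 0 ∷ scaleE (suc k) h) ≡ (suc j ℕ.* suc k ∷ 0 ∷ scaleE (suc k) h)
    Q1Y j k = cong (λ x → suc k ℕ.+ j ℕ.* suc k ∷ 0 ∷ x) (zero+E _)
    TqY : ∀ j k → (k ∷ 1 ∷ zeroE) +E (j ℕ.* suc k ∷ 0 ∷ scaleE (suc k) h) ≡ (j ℕ.+ suc j ℕ.* k ∷ 1 ∷ scaleE (suc k) h)
    TqY j k = cong₂ (λ x y → x ∷ 1 ∷ y) (arithmetic j k) (zero+E _)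
      where
      arithmetic : ∀ j k → k ℕ.+ j ℕ.* suc k ≡ j ℕ.+ suc j ℕ.* k
      arithmetic = ℕ-solve-∀

  functional-equation : ∀ j →
    AgreeBelow K ((oneP -P mono (j ∷ 0 ∷ h)) *P G j) ((oneP -P mono (j ∷ 1 ∷ h)) *P G (suc j))
  functional-equation j d d<K = begin
    ((oneP -P mono (j ∷ 0 ∷ h)) *P G j) d
      ≡⟨ oneP-minus-*P-∑ₚ K (j ∷ 0 ∷ h) (term j) (qShifted j) (mono-*P-term j) d ⟩
    (G j -P ∑ₚ K (qShifted j)) d
      ≡⟨ ∑ₚ-minus-∑ₚ K' (term j) (qShifted j) d (*P-mono-K-vanishes (fqt K') _ 0 d d<K) ⟩
    term j 0 d + ∑< K' (λ k → term j (suc k) d - qShifted j k d)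
      ≡⟨ cong₂ _+_ (term-zero j d) (∑<-ext K' (λ k → term-suc j k d)) ⟩
    term (suc j) 0 d + ∑< K' (λ k → term (suc j) (suc k) d - tShifted j k d)
      ≡⟨ sym (∑ₚ-minus-∑ₚ K' (term (suc j)) (tShifted j) d (*P-mono-K-vanishes (fqt K') _ 1 d d<K)) ⟩
    (G (suc j) -P ∑ₚ K (tShifted j)) d
      ≡⟨ sym (oneP-minus-*P-∑ₚ K (j ∷ 1 ∷ h) (term (suc j)) (tShifted j) (tmono-*P-term j) d) ⟩
    ((oneP -P mono (j ∷ 1 ∷ h)) *P G (suc j)) d ∎

  G-step : ∀ j → AgreeBelow K (G j) (g j *P G (suc j))
  G-step j d d<K = begin
    G j d                                 ≡⟨ sym (*P-identityˡ (G j) d) ⟩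
    (oneP *P G j) d                       ≡⟨ *P-cong {b = G j} (λ e → sym (geomP-inverse (j ∷ 0 ∷ h) j0h≥1 e)) (λ _ → refl) d ⟩
    ((geomP (j ∷ 0 ∷ h) *P X0) *P G j) d  ≡⟨ *P-assoc (geomP (j ∷ 0 ∷ h)) X0 (G j) d ⟩
    (geomP (j ∷ 0 ∷ h) *P (X0 *P G j)) d  ≡⟨ *P-agreeBelowˡ (geomP (j ∷ 0 ∷ h)) (functional-equation j) d d<K ⟩
    (geomP (j ∷ 0 ∷ h) *P (X1 *P G (suc j))) d
      ≡⟨ solve 3 (λ a b c → a :* (b :* c) := (b :* a) :* c) (λ _ → refl) (geomP (j ∷ 0 ∷ h)) X1 (G (suc j)) d ⟩
    (g j *P G (suc j)) d                  ∎
    where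
    X0 X1 : PS (Var N)
    X0 = oneP -P mono (j ∷ 0 ∷ h)
    X1 = oneP -P mono (j ∷ 1 ∷ h)
    j0h≥1 : 1 ≤ totalDeg (j ∷ 0 ∷ h)
    j0h≥1 = ℕ.≤-trans h≥1 (tdeg-∷∷ j 0 h)

  G-iterate : ∀ r j (ι : ℕ → ℕ) → (∀ i → ι i ≡ j ℕ.+ i) →
    AgreeBelow K (G j) (prodP (List.map g (applyUpTo ι r)) *P G (j ℕ.+ r))
  G-iterate zero    j ι _  d _   = sym (trans (*P-identityˡ (G (j ℕ.+ 0)) d) (cong (λ x → G x d) (ℕ.+-identityʳ j)))
  G-iterate (suc r) j ι ι≡ d d<K = begin
    G j d                            ≡⟨ G-step j d d<K ⟩
    (g j *P G (suc j)) d
      ≡⟨ *P-agreeBelowˡ (g j) (G-iterate r (suc j) (ι ∘ suc) (λ i → trans (ι≡ (suc i)) (ℕ.+-suc j i))) d d<K ⟩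
    (g j *P (Π *P G (suc j ℕ.+ r))) d ≡⟨ sym (*P-assoc (g j) Π (G (suc j ℕ.+ r)) d) ⟩
    ((g j *P Π) *P G (suc j ℕ.+ r)) d
      ≡⟨ cong₂ (λ a b → ((g a *P Π) *P G b) d) (trans (sym (ℕ.+-identityʳ j)) (sym (ι≡ 0))) (sym (ℕ.+-suc j r)) ⟩
    ((g (ι 0) *P Π) *P G (j ℕ.+ suc r)) d ∎
    where
    Π : PS (Var N)
    Π = prodP (List.map g (applyUpTo (ι ∘ suc) r))

  G-≡-oneP : ∀ M d → qdeg d < M → G M d ≡ oneP d
  G-≡-oneP M d d<M = begin
    G M d                                  ≡⟨ ∑<-suc K' (λ k → term M k d) ⟩
    term M 0 d + ∑< K' (λ k → term M (suc k) d)
      ≡⟨ cong₂ _+_ term-M-0 (trans (∑<-ext K' term-M-suc) (∑<-zero K')) ⟩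
    oneP d + 0ℤ                            ≡⟨ ℤ.+-identityʳ _ ⟩
    oneP d                                 ∎
    where
    term-M-0 : term M 0 d ≡ oneP d
    term-M-0 = begin
      (fqt 0 *P mono (M ℕ.* 0 ∷ 0 ∷ scaleE 0 h)) d
        ≡⟨ *P-congˡ (fqt 0) (mono-cong (cong₂ _∷_ (ℕ.*-zeroʳ M) (cong (0 ∷_) (scaleE-zero h)))) d ⟩
      (fqt 0 *P oneP) d                    ≡⟨ *P-identityʳ (fqt 0) d ⟩
      (oneP *P oneP) d                     ≡⟨ *P-identityˡ oneP d ⟩
      oneP d                               ∎
    term-M-suc : ∀ k → term M (suc k) d ≡ 0ℤ
    term-M-suc k = mono-*ʳ-≰ (M ℕ.* suc k ∷ 0 ∷ scaleE (suc k) h) (fqt (suc k)) d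
      (λ u≤d → ℕ.<⇒≱ d<M (ℕ.≤-trans (ℕ.m≤m*n M (suc k)) (qdeg-mono-≤ u≤d)))

  Fqt-agreeBelow : AgreeBelow K (Fqt h) (G 0)
  Fqt-agreeBelow d d<K = sym (begin
    G 0 d        ≡⟨ G-iterate M 0 id (λ _ → refl) d d<K ⟩
    (P *P G M) d ≡⟨ ∑≤-cong d (λ d' d'≤d → cong (P d' *_) (G-≡-oneP M (d ∸E d') (s≤s (qdeg-mono-≤ (∸E-≤E d d'))))) ⟩
    (P *P oneP) d ≡⟨ *P-identityʳ P d ⟩
    P d          ∎)
    where
    M : ℕ
    M = suc (qdeg d)
    P : PS (Var N)
    P = prodP (List.map g (upTo M))

map-allFin-suc : ∀ {A : Set} m (f : Fin (suc m) → A) →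
  List.map f (allFin (suc m)) ≡ f Fin.zero ∷ List.map (f ∘ Fin.suc) (allFin m)
map-allFin-suc m f = trans (List.map-tabulate id f) (cong (f Fin.zero ∷_) (sym (List.map-tabulate id (f ∘ Fin.suc))))

ZFree : ∀ {N} → PS (Var N) → Set
ZFree {N} P = ∀ a b (s : Exp N) → ¬ s ≡ zeroE → P (a ∷ b ∷ s) ≡ 0ℤ

zfree-mono : ∀ {N} x y → ZFree {N} (mono (x ∷ y ∷ zeroE))
zfree-mono x y a b s s≢0 = mono-no {u = x ∷ y ∷ zeroE} {v = a ∷ b ∷ s} (λ p → s≢0 (sym (Vec.∷-injectiveʳ (Vec.∷-injectiveʳ p))))

zfree-oneP-minus-mono : ∀ {N} x y → ZFree {N} (oneP -P mono (x ∷ y ∷ zeroE))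
zfree-oneP-minus-mono x y a b s s≢0 = cong₂ _-_ (zfree-mono 0 0 a b s s≢0) (zfree-mono x y a b s s≢0)

zfree-geomP : ∀ {N} x → ZFree {N} (geomP (x ∷ 0 ∷ zeroE))
zfree-geomP x a b s s≢0 = trans (sumℤ-map-upTo _ K) (trans (∑<-ext K term≡0) (∑<-zero K))
  where
  K : ℕ
  K = suc (totalDeg (a ∷ b ∷ s))
  term≡0 : ∀ k → mono (scaleE k (x ∷ 0 ∷ zeroE)) (a ∷ b ∷ s) ≡ 0ℤ
  term≡0 k = mono-no {u = scaleE k (x ∷ 0 ∷ zeroE)} {v = a ∷ b ∷ s}
    (λ p → s≢0 (trans (sym (Vec.∷-injectiveʳ (Vec.∷-injectiveʳ p))) (scaleE-zeroE k)))

zfree-*P : ∀ {N} {P Q : PS (Var N)} → ZFree P → ZFree Q → ZFree (P *P Q)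
zfree-*P {N} {P} {Q} zP zQ a b s s≢0 = trans (∑≤-cong (a ∷ b ∷ s) vanishes) (∑≤-zero (a ∷ b ∷ s))
  where
  vanishes : ∀ d → d ≤E (a ∷ b ∷ s) → P d * Q ((a ∷ b ∷ s) ∸E d) ≡ 0ℤ
  vanishes (i ∷ j ∷ s') _ with s' ≟E zeroE
  ... | yes refl = trans (cong (P (i ∷ j ∷ zeroE) *_)
                           (zQ (a ∸ i) (b ∸ j) (s ∸E zeroE) (λ r → s≢0 (trans (sym (∸E-zero s)) r))))
                         (ℤ.*-zeroʳ (P (i ∷ j ∷ zeroE)))
  ... | no s'≢0 = trans (cong (_* Q ((a ∷ b ∷ s) ∸E (i ∷ j ∷ s'))) (zP i j s' s'≢0))
                        (ℤ.*-zeroˡ (Q ((a ∷ b ∷ s) ∸E (i ∷ j ∷ s'))))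

zfree-prodP : ∀ {N} {A : Set} (f : A → PS (Var N)) → (∀ x → ZFree (f x)) → ∀ xs → ZFree (prodP (List.map f xs))
zfree-prodP f zf []       = zfree-mono 0 0
zfree-prodP f zf (x ∷ xs) = zfree-*P {P = f x} {Q = prodP (List.map f xs)} (zf x) (zfree-prodP f zf xs)

zfree-fqt : ∀ {N} k → ZFree (fqt {N} k)
zfree-fqt {N} k = zfree-*P {P = tqPoch k} {Q = invqqPoch k}
  (zfree-prodP (λ i → oneP -P mono (i ∷ 1 ∷ zeroE)) (λ i → zfree-oneP-minus-mono i 1) (upTo k))
  (zfree-prodP (λ i → geomP {Var N} (suc i ∷ 0 ∷ zeroE)) (λ i → zfree-geomP (suc i)) (upTo k))

zfree-weight : ∀ {n} (T : RootedTree n) σ → ZFree (weight T σ)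
zfree-weight {n} T σ = zfree-*P {P = fqt (σ root)} {Q = prodP (List.map (fqt ∘ increment) (allFin n))}
  (zfree-fqt (σ root)) (zfree-prodP (fqt ∘ increment) (λ i → zfree-fqt (increment i)) (allFin n))
  where
  increment : Fin n → ℕ
  increment i = σ (Fin.suc i) ∸ σ (parent T i)

zfree-*P-mono : ∀ {N} (P : PS (Var N)) → ZFree P → ∀ a b (σ s : Exp N) →
  (P *P mono (0 ∷ 0 ∷ σ)) (a ∷ b ∷ s) ≡ mono s σ * P (a ∷ b ∷ zeroE)
zfree-*P-mono P zP a b σ s with σ ≤E? s | mono-*ʳ (0 ∷ 0 ∷ σ) P (a ∷ b ∷ s) | s ≟E σ
... | yes σ≤s | eq | yes refl = trans eq (trans (cong (λ x → P (a ∷ b ∷ x)) (∸E-self σ)) (sym (ℤ.*-identityˡ (P (a ∷ b ∷ zeroE)))))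
... | yes σ≤s | eq | no s≢σ = trans eq (trans (zP a b (s ∸E σ) s∸σ≢0) (sym (ℤ.*-zeroˡ (P (a ∷ b ∷ zeroE)))))
  where
  s∸σ≢0 : ¬ s ∸E σ ≡ zeroE
  s∸σ≢0 r = s≢σ (sym (trans (sym (+E-zero σ)) (trans (cong (σ +E_) (sym r)) (+E-∸E σ≤s))))
... | no σ≰s  | _  | yes refl = ⊥-elim (σ≰s (≤E-refl σ))
... | no σ≰s  | eq | no _ = trans eq (sym (ℤ.*-zeroˡ (P (a ∷ b ∷ zeroE))))

_≗ᵇ_ : ∀ {m} → (Fin m → ℕ) → (Fin m → ℕ) → Bool
_≗ᵇ_ {zero}  c κ = true
_≗ᵇ_ {suc m} c κ = does (c Fin.zero ℕ.≟ κ Fin.zero) ∧ ((c ∘ Fin.suc) ≗ᵇ (κ ∘ Fin.suc))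

≗ᵇ-sound : ∀ {m} (c κ : Fin m → ℕ) → (c ≗ᵇ κ) ≡ true → c ≗ κ
≗ᵇ-sound {suc m} c κ = split (c Fin.zero ℕ.≟ κ Fin.zero)
  where
  split : (c₀≟κ₀ : Dec (c Fin.zero ≡ κ Fin.zero)) → (does c₀≟κ₀ ∧ ((c ∘ Fin.suc) ≗ᵇ (κ ∘ Fin.suc))) ≡ true → c ≗ κ
  split (yes c₀≡κ₀) eq Fin.zero    = c₀≡κ₀
  split (yes c₀≡κ₀) eq (Fin.suc i) = ≗ᵇ-sound (c ∘ Fin.suc) (κ ∘ Fin.suc) eq i

≗ᵇ-complete : ∀ {m} (c κ : Fin m → ℕ) → c ≗ κ → (c ≗ᵇ κ) ≡ true
≗ᵇ-complete {zero}  c κ c≗κ = refl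
≗ᵇ-complete {suc m} c κ c≗κ = cong₂ _∧_ (dec-true (c Fin.zero ℕ.≟ κ Fin.zero) (c≗κ Fin.zero))
  (≗ᵇ-complete (c ∘ Fin.suc) (κ ∘ Fin.suc) (c≗κ ∘ Fin.suc))

module MultiSum (K' : ℕ) where

  ∑ᶠ : (m : ℕ) → ((Fin m → ℕ) → ℤ) → ℤ
  ∑ᶠ zero    F = F (λ ())
  ∑ᶠ (suc m) F = ∑< (suc K') (λ k → ∑ᶠ m (λ κ → F (k ∷ᶠ κ)))

  ∑ᶠ-ext : ∀ m {F F'} → (∀ κ → F κ ≡ F' κ) → ∑ᶠ m F ≡ ∑ᶠ m F'
  ∑ᶠ-ext zero    p = p (λ ())
  ∑ᶠ-ext (suc m) p = ∑<-ext (suc K') (λ k → ∑ᶠ-ext m (λ κ → p (k ∷ᶠ κ)))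

  *-∑ᶠ : ∀ m c F → c * ∑ᶠ m F ≡ ∑ᶠ m (λ κ → c * F κ)
  *-∑ᶠ zero    c F = refl
  *-∑ᶠ (suc m) c F = trans (*-∑< (suc K') c _) (∑<-ext (suc K') (λ k → *-∑ᶠ m c (λ κ → F (k ∷ᶠ κ))))

  ∑ᶠ-δ : ∀ m (c : Fin m → ℕ) (G : (Fin m → ℕ) → ℤ) →
    (∀ κ κ' → κ ≗ κ' → G κ ≡ G κ') → (∀ i → c i ≤ K') →
    ∑ᶠ m (λ κ → ⟦ c ≗ᵇ κ ⟧ * G κ) ≡ G c
  ∑ᶠ-δ zero    c G G-resp c≤K' = trans (ℤ.*-identityˡ _) (G-resp _ _ (λ ()))
  ∑ᶠ-δ (suc m) c G G-resp c≤K' = begin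
    ∑< (suc K') (λ k → ∑ᶠ m (λ κ → ⟦ does (c₀ ℕ.≟ k) ∧ (c ∘ Fin.suc) ≗ᵇ κ ⟧ * G (k ∷ᶠ κ)))
      ≡⟨ ∑<-ext (suc K') (λ k → ∑ᶠ-ext m (λ κ →
           trans (cong (_* G (k ∷ᶠ κ)) (⟦∧⟧ (does (c₀ ℕ.≟ k)) _)) (ℤ.*-assoc (δ c₀ k) _ _))) ⟩
    ∑< (suc K') (λ k → ∑ᶠ m (λ κ → δ c₀ k * (⟦ (c ∘ Fin.suc) ≗ᵇ κ ⟧ * G (k ∷ᶠ κ))))
      ≡⟨ ∑<-ext (suc K') (λ k → sym (*-∑ᶠ m (δ c₀ k) _)) ⟩
    ∑< (suc K') (λ k → δ c₀ k * ∑ᶠ m (λ κ → ⟦ (c ∘ Fin.suc) ≗ᵇ κ ⟧ * G (k ∷ᶠ κ)))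
      ≡⟨ ∑<-ext (suc K') (λ k → cong (δ c₀ k *_) (∑ᶠ-δ m (c ∘ Fin.suc) (λ κ → G (k ∷ᶠ κ))
            (λ κ κ' κ≗κ' → G-resp _ _ (λ { Fin.zero → refl ; (Fin.suc i) → κ≗κ' i })) (c≤K' ∘ Fin.suc))) ⟩
    ∑< (suc K') (λ k → δ c₀ k * G (k ∷ᶠ (c ∘ Fin.suc)))
      ≡⟨ ∑<-δ K' c₀ _ ⟩
    (if does (c₀ ℕ.≤? K') then G (c₀ ∷ᶠ (c ∘ Fin.suc)) else 0ℤ)
      ≡⟨ cong (if_then G (c₀ ∷ᶠ (c ∘ Fin.suc)) else 0ℤ) (dec-true (c₀ ℕ.≤? K') (c≤K' Fin.zero)) ⟩
    G (c₀ ∷ᶠ (c ∘ Fin.suc))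
      ≡⟨ G-resp _ _ (λ { Fin.zero → refl ; (Fin.suc i) → refl }) ⟩
    G c ∎
    where
    c₀ : ℕ
    c₀ = c Fin.zero

  ∑ᶠₚ : ∀ {M} (m : ℕ) → ((Fin m → ℕ) → PS M) → PS M
  ∑ᶠₚ m F e = ∑ᶠ m (λ κ → F κ e)

  *P-∑ᶠₚ : ∀ {M} m (P : PS M) F → (P *P ∑ᶠₚ m F) ≗ ∑ᶠₚ m (λ κ → P *P F κ)
  *P-∑ᶠₚ zero    P F e = refl
  *P-∑ᶠₚ (suc m) P F e = trans (*P-∑ₚ P (suc K') (λ k → ∑ᶠₚ m (λ κ → F (k ∷ᶠ κ))) e)
    (∑<-ext (suc K') (λ k → *P-∑ᶠₚ m P (λ κ → F (k ∷ᶠ κ)) e))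

  prodP-∑ₚ : ∀ {M} m (A : Fin m → ℕ → PS M) →
    prodP (List.map (λ v → ∑ₚ (suc K') (A v)) (allFin m))
      ≗ ∑ᶠₚ m (λ κ → prodP (List.map (λ v → A v (κ v)) (allFin m)))
  prodP-∑ₚ             zero    A e = refl
  prodP-∑ₚ {M} (suc m) A e = begin
    prodP (List.map (λ v → ∑ₚ (suc K') (A v)) (allFin (suc m))) e
      ≡⟨ cong (λ xs → prodP xs e) (map-allFin-suc m (λ v → ∑ₚ (suc K') (A v))) ⟩
    (∑ₚ (suc K') (A Fin.zero) *P prodP (List.map (λ v → ∑ₚ (suc K') (A (Fin.suc v))) (allFin m))) e
      ≡⟨ *P-congˡ (∑ₚ (suc K') (A Fin.zero)) (prodP-∑ₚ m (A ∘ Fin.suc)) e ⟩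
    (∑ₚ (suc K') (A Fin.zero) *P ∑ᶠₚ m R) e
      ≡⟨ ∑ₚ-*P (∑ᶠₚ m R) (suc K') (A Fin.zero) e ⟩
    ∑ₚ (suc K') (λ k → A Fin.zero k *P ∑ᶠₚ m R) e
      ≡⟨ ∑<-ext (suc K') (λ k → *P-∑ᶠₚ m (A Fin.zero k) R e) ⟩
    ∑ₚ (suc K') (λ k → ∑ᶠₚ m (λ κ → A Fin.zero k *P R κ)) e
      ≡⟨ ∑<-ext (suc K') (λ k → ∑ᶠ-ext m (λ κ →
           cong (λ xs → prodP xs e) (sym (map-allFin-suc m (λ v → A v ((k ∷ᶠ κ) v)))))) ⟩
    ∑ᶠₚ (suc m) (λ κ → prodP (List.map (λ v → A v (κ v)) (allFin (suc m)))) e ∎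
    where
    R : (Fin m → ℕ) → PS M
    R κ = prodP (List.map (λ v → A (Fin.suc v) (κ v)) (allFin m))

∑E : ∀ {N m} → (Fin m → ℕ) → (Fin m → Exp N) → List (Fin m) → Exp N
∑E κ h []       = zeroE
∑E κ h (v ∷ vs) = scaleE (κ v) (h v) +E ∑E κ h vs

prodP-*P-mono : ∀ {N m} (κ : Fin m → ℕ) (h : Fin m → Exp N) vs →
  prodP (List.map (λ v → fqt (κ v) *P mono (0 ∷ 0 ∷ scaleE (κ v) (h v))) vs)
    ≗ (prodP (List.map (λ v → fqt {N} (κ v)) vs) *P mono (0 ∷ 0 ∷ ∑E κ h vs))
prodP-*P-mono         κ h []       e = sym (*P-identityˡ oneP e)
prodP-*P-mono {N} {m} κ h (v ∷ vs) e = begin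
  ((F *P X) *P prodP (List.map (λ v → fqt (κ v) *P mono (0 ∷ 0 ∷ scaleE (κ v) (h v))) vs)) e
    ≡⟨ *P-congˡ (F *P X) (prodP-*P-mono κ h vs) e ⟩
  ((F *P X) *P (Π *P Y)) e
    ≡⟨ solve 4 (λ F X Π Y → (F :* X) :* (Π :* Y) := (F :* Π) :* (X :* Y)) (λ _ → refl) F X Π Y e ⟩
  ((F *P Π) *P (X *P Y)) e
    ≡⟨ *P-congˡ (F *P Π) (mono-*P-mono (0 ∷ 0 ∷ scaleE (κ v) (h v)) (0 ∷ 0 ∷ ∑E κ h vs)) e ⟩
  ((F *P Π) *P mono (0 ∷ 0 ∷ ∑E κ h (v ∷ vs))) e ∎
  where
  open PowerSeriesRing (Var N)
  F X Y Π : PS (Var N)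
  F = fqt (κ v)
  X = mono (0 ∷ 0 ∷ scaleE (κ v) (h v))
  Y = mono (0 ∷ 0 ∷ ∑E κ h vs)
  Π = prodP (List.map (λ v → fqt (κ v)) vs)

∑ℕ : ∀ {A : Set} → List A → (A → ℕ) → ℕ
∑ℕ xs f = List.foldr ℕ._+_ 0 (List.map f xs)

∑ℕ-ext : ∀ {A : Set} (xs : List A) {f g : A → ℕ} → (∀ x → f x ≡ g x) → ∑ℕ xs f ≡ ∑ℕ xs g
∑ℕ-ext xs p = cong (List.foldr ℕ._+_ 0) (List.map-cong p xs)

∑ℕ-+ : ∀ {A : Set} (xs : List A) f g → ∑ℕ xs (λ x → f x ℕ.+ g x) ≡ ∑ℕ xs f ℕ.+ ∑ℕ xs g
∑ℕ-+ []       f g = refl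
∑ℕ-+ (x ∷ xs) f g = trans (cong (f x ℕ.+ g x ℕ.+_) (∑ℕ-+ xs f g)) (ℕ+.interchange (f x) (g x) (∑ℕ xs f) (∑ℕ xs g))

∑ℕ-allFin-suc : ∀ m (f : Fin (suc m) → ℕ) → ∑ℕ (allFin (suc m)) f ≡ f Fin.zero ℕ.+ ∑ℕ (allFin m) (f ∘ Fin.suc)
∑ℕ-allFin-suc m f = cong (List.foldr ℕ._+_ 0) (map-allFin-suc m f)

[_≟_] : ∀ {m} → Fin m → Fin m → ℕ
[ w ≟ c ] = if does (w Fin.≟ c) then 1 else 0

∑ℕ-δ : ∀ m (c : Fin m) (κ : Fin m → ℕ) → ∑ℕ (allFin m) (λ w → κ w ℕ.* [ w ≟ c ]) ≡ κ c
∑ℕ-δ (suc m) Fin.zero κ = begin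
  ∑ℕ (allFin (suc m)) (λ w → κ w ℕ.* [ w ≟ Fin.zero ])    ≡⟨ ∑ℕ-allFin-suc m _ ⟩
  κ Fin.zero ℕ.* 1 ℕ.+ ∑ℕ (allFin m) (λ w → κ (Fin.suc w) ℕ.* 0)
    ≡⟨ cong₂ ℕ._+_ (ℕ.*-identityʳ _) (trans (∑ℕ-ext (allFin m) (λ w → ℕ.*-zeroʳ (κ (Fin.suc w)))) (∑ℕ-zero (allFin m))) ⟩
  κ Fin.zero ℕ.+ 0                                         ≡⟨ ℕ.+-identityʳ _ ⟩
  κ Fin.zero                                               ∎
  where
  ∑ℕ-zero : ∀ (ws : List (Fin m)) → ∑ℕ ws (λ _ → 0) ≡ 0
  ∑ℕ-zero []       = refl
  ∑ℕ-zero (_ ∷ ws) = ∑ℕ-zero ws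
∑ℕ-δ (suc m) (Fin.suc c) κ = begin
  ∑ℕ (allFin (suc m)) (λ w → κ w ℕ.* [ w ≟ Fin.suc c ])                ≡⟨ ∑ℕ-allFin-suc m _ ⟩
  κ Fin.zero ℕ.* 0 ℕ.+ ∑ℕ (allFin m) (λ w → κ (Fin.suc w) ℕ.* [ w ≟ c ])
    ≡⟨ cong₂ ℕ._+_ (ℕ.*-zeroʳ (κ Fin.zero)) (∑ℕ-δ m c (κ ∘ Fin.suc)) ⟩
  κ (Fin.suc c)                                                          ∎

lookup-∑E : ∀ {N m} (κ : Fin m → ℕ) (h : Fin m → Exp N) vs i →
  lookup (∑E κ h vs) i ≡ ∑ℕ vs (λ w → κ w ℕ.* lookup (h w) i)
lookup-∑E κ h []       i = Vec.lookup-replicate i 0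
lookup-∑E κ h (w ∷ vs) i = trans (Vec.lookup-zipWith ℕ._+_ i (scaleE (κ w) (h w)) (∑E κ h vs))
  (cong₂ ℕ._+_ (Vec.lookup-map i (κ w ℕ.*_) (h w)) (lookup-∑E κ h vs i))

≗-lookup⇒≡ : ∀ {A : Set} {m} (u v : Vec A m) → (∀ i → lookup u i ≡ lookup v i) → u ≡ v
≗-lookup⇒≡ u v p = trans (sym (Vec.tabulate∘lookup u)) (trans (Vec.tabulate-cong p) (Vec.tabulate∘lookup v))

module Tree {n : ℕ} (T : RootedTree n) where

  chain-fuel : ∀ f f' v → Fin.toℕ v ≤ f → Fin.toℕ v ≤ f' → chain T f v ≡ chain T f' v
  chain-fuel f        f'       Fin.zero    _       _        = refl
  chain-fuel (suc f) (suc f') (Fin.suc i) (s≤s p) (s≤s p') =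
    cong (Fin.suc i ∷_) (chain-fuel f f' (parent T i) (ℕ.≤-trans (parent< T i) p) (ℕ.≤-trans (parent< T i) p'))

  pathToRoot-suc : ∀ i → pathToRoot T (Fin.suc i) ≡ Fin.suc i ∷ pathToRoot T (parent T i)
  pathToRoot-suc i = cong (Fin.suc i ∷_) (chain-fuel (Fin.toℕ i) _ (parent T i) (parent< T i) ℕ.≤-refl)

  ≼-refl : ∀ v → T ⊢ v ≼ v
  ≼-refl Fin.zero    = here refl
  ≼-refl (Fin.suc i) = here refl

  ≼-parent : ∀ i → T ⊢ Fin.suc i ≼ parent T i
  ≼-parent i = subst (parent T i ∈_) (sym (pathToRoot-suc i)) (there (≼-refl (parent T i)))

  chain-toℕ-≤ : ∀ f v w → w ∈ chain T f v → Fin.toℕ w ≤ Fin.toℕ v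
  chain-toℕ-≤ f       Fin.zero    w (here refl) = ℕ.≤-refl
  chain-toℕ-≤ zero    (Fin.suc i) w (here refl) = ℕ.≤-refl
  chain-toℕ-≤ (suc f) (Fin.suc i) w (here refl) = ℕ.≤-refl
  chain-toℕ-≤ (suc f) (Fin.suc i) w (there p)   =
    ℕ.≤-trans (chain-toℕ-≤ f (parent T i) w p) (ℕ.≤-trans (parent< T i) (ℕ.n≤1+n _))

  ≼⇒toℕ-≥ : ∀ {v w} → T ⊢ v ≼ w → Fin.toℕ w ≤ Fin.toℕ v
  ≼⇒toℕ-≥ {v} {w} = chain-toℕ-≤ (Fin.toℕ v) v w

  [_≼_] : Vertex n → Vertex n → ℕ
  [ v ≼ w ] = if does (T ⊢ v ≼? w) then 1 else 0

  [root≼] : ∀ w → [ Fin.zero ≼ w ] ≡ [ w ≟ Fin.zero ]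
  [root≼] w = cong (if_then 1 else 0) (Bool.∨-identityʳ (does (w Fin.≟ Fin.zero)))

  -- the two summands are disjoint: an ancestor of the parent has a smaller label than suc i
  [suc≼] : ∀ i w → [ Fin.suc i ≼ w ] ≡ [ w ≟ Fin.suc i ] ℕ.+ [ parent T i ≼ w ]
  [suc≼] i w = trans (cong (λ vs → if does (w ∈? vs) then 1 else 0) (pathToRoot-suc i))
    (if-∨ (does (w Fin.≟ Fin.suc i)) (does (w ∈? pathToRoot T (parent T i)))
      (λ w≡1+i → dec-false (w ∈? pathToRoot T (parent T i)) (λ parent≼w →
        ℕ.<⇒≱ (ℕ.≤-<-trans (parent< T i) (ℕ.n<1+n (Fin.toℕ i)))
              (subst (λ u → Fin.toℕ u ≤ Fin.toℕ (parent T i)) (≟-true⇒≡ w≡1+i) (≼⇒toℕ-≥ parent≼w)))))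
    where
    open import Data.List.Membership.DecPropositional Fin._≟_ using (_∈?_)
    ≟-true⇒≡ : does (w Fin.≟ Fin.suc i) ≡ true → w ≡ Fin.suc i
    ≟-true⇒≡ eq with w Fin.≟ Fin.suc i
    ... | yes w≡1+i = w≡1+i
    if-∨ : ∀ a x → (a ≡ true → x ≡ false) → (if a ∨ x then 1 else 0) ≡ (if a then 1 else 0) ℕ.+ (if x then 1 else 0)
    if-∨ true  x a⇒¬x rewrite a⇒¬x refl = refl
    if-∨ false x _ = refl

  ancestorSum : (Vertex n → ℕ) → Vertex n → ℕ
  ancestorSum κ v = ∑ℕ (allFin (suc n)) (λ w → κ w ℕ.* [ v ≼ w ])

  ancestorSum-root : ∀ κ → ancestorSum κ Fin.zero ≡ κ Fin.zero
  ancestorSum-root κ = trans (∑ℕ-ext (allFin (suc n)) (λ w → cong (κ w ℕ.*_) ([root≼] w))) (∑ℕ-δ (suc n) Fin.zero κ)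

  ancestorSum-suc : ∀ κ i → ancestorSum κ (Fin.suc i) ≡ κ (Fin.suc i) ℕ.+ ancestorSum κ (parent T i)
  ancestorSum-suc κ i = begin
    ancestorSum κ (Fin.suc i)
      ≡⟨ ∑ℕ-ext (allFin (suc n)) (λ w → trans (cong (κ w ℕ.*_) ([suc≼] i w)) (ℕ.*-distribˡ-+ (κ w) _ _)) ⟩
    ∑ℕ (allFin (suc n)) (λ w → κ w ℕ.* [ w ≟ Fin.suc i ] ℕ.+ κ w ℕ.* [ parent T i ≼ w ])
      ≡⟨ ∑ℕ-+ (allFin (suc n)) (λ w → κ w ℕ.* [ w ≟ Fin.suc i ]) (λ w → κ w ℕ.* [ parent T i ≼ w ]) ⟩
    ∑ℕ (allFin (suc n)) (λ w → κ w ℕ.* [ w ≟ Fin.suc i ]) ℕ.+ ancestorSum κ (parent T i)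
      ≡⟨ cong (ℕ._+ ancestorSum κ (parent T i)) (∑ℕ-δ (suc n) (Fin.suc i) κ) ⟩
    κ (Fin.suc i) ℕ.+ ancestorSum κ (parent T i) ∎

  ancestorSum-cong : ∀ {κ κ'} → κ ≗ κ' → ancestorSum κ ≗ ancestorSum κ'
  ancestorSum-cong κ≗κ' v = ∑ℕ-ext (allFin (suc n)) (λ w → cong (ℕ._* [ v ≼ w ]) (κ≗κ' w))

  ancestorSum-antitone : ∀ κ {x y} → T ⊢ x ≼ y → ancestorSum κ y ≤ ancestorSum κ x
  ancestorSum-antitone κ {x} = go (Fin.toℕ x) x ℕ.≤-refl
    where
    go : ∀ f x → Fin.toℕ x ≤ f → ∀ {y} → y ∈ chain T f x → ancestorSum κ y ≤ ancestorSum κ x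
    go f       Fin.zero    _       (here refl) = ℕ.≤-refl
    go (suc f) (Fin.suc i) _       (here refl) = ℕ.≤-refl
    go (suc f) (Fin.suc i) (s≤s i≤f) (there y∈) = ℕ.≤-trans (go f (parent T i) (ℕ.≤-trans (parent< T i) i≤f) y∈)
      (ℕ.≤-trans (ℕ.m≤n+m _ (κ (Fin.suc i))) (ℕ.≤-reflexive (sym (ancestorSum-suc κ i))))

  increments : Exp (suc n) → Vertex n → ℕ
  increments σ Fin.zero    = lookup σ Fin.zero
  increments σ (Fin.suc i) = lookup σ (Fin.suc i) ∸ lookup σ (parent T i)

  ancestorSum-increments : ∀ σ → IsTPartition T (lookup σ) → ∀ v → ancestorSum (increments σ) v ≡ lookup σ v
  ancestorSum-increments σ σ-mono v = go (Fin.toℕ v) v ℕ.≤-refl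
    where
    go : ∀ f v → Fin.toℕ v ≤ f → ancestorSum (increments σ) v ≡ lookup σ v
    go f       Fin.zero    _         = ancestorSum-root (increments σ)
    go (suc f) (Fin.suc i) (s≤s i≤f) = trans (ancestorSum-suc (increments σ) i)
      (trans (cong (increments σ (Fin.suc i) ℕ.+_) (go f (parent T i) (ℕ.≤-trans (parent< T i) i≤f)))
             (ℕ.m∸n+n≡m (σ-mono (Fin.suc i) (parent T i) (≼-parent i))))

  ancestorSum-inverse : ∀ σ κ → ancestorSum κ ≗ lookup σ → (increments σ ≗ κ) × IsTPartition T (lookup σ)
  ancestorSum-inverse σ κ sum≗σ = increments≗κ , σ-mono
    where
    increments≗κ : increments σ ≗ κ
    increments≗κ Fin.zero    = trans (sym (sum≗σ Fin.zero)) (ancestorSum-root κ)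
    increments≗κ (Fin.suc i) = trans (cong₂ _∸_ (sym (sum≗σ (Fin.suc i))) (sym (sum≗σ (parent T i))))
      (trans (cong (_∸ ancestorSum κ (parent T i)) (ancestorSum-suc κ i)) (ℕ.m+n∸n≡m (κ (Fin.suc i)) (ancestorSum κ (parent T i))))
    σ-mono : IsTPartition T (lookup σ)
    σ-mono x y x≼y = subst₂ _≤_ (sum≗σ y) (sum≗σ x) (ancestorSum-antitone κ x≼y)

  hookCombination : (Vertex n → ℕ) → Exp (suc n)
  hookCombination κ = ∑E κ (hookExp T) (allFin (suc n))

  lookup-hookCombination : ∀ κ v → lookup (hookCombination κ) v ≡ ancestorSum κ v
  lookup-hookCombination κ v = trans (lookup-∑E κ (hookExp T) (allFin (suc n)) v)
    (∑ℕ-ext (allFin (suc n)) (λ w → cong (κ w ℕ.*_) (Vec.lookup∘tabulate (λ u → [ u ≼ w ]) v)))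

  1≤tdeg-hookExp : ∀ v → 1 ≤ totalDeg (hookExp T v)
  1≤tdeg-hookExp v = subst (_≤ totalDeg (hookExp T v))
    (trans (Vec.lookup∘tabulate (λ u → [ u ≼ v ]) v) (cong (if_then 1 else 0) (dec-true (T ⊢ v ≼? v) (≼-refl v))))
    (lookup≤tdeg (hookExp T v) v)

  hookCombination-≟ : ∀ σ κ →
    does (σ ≟E hookCombination κ) ≡ does (isTPartition? T (lookup σ)) ∧ (increments σ ≗ᵇ κ)
  hookCombination-≟ σ κ = compare (σ ≟E hookCombination κ) (isTPartition? T (lookup σ)) _ refl
    where
    sum≗σ : σ ≡ hookCombination κ → ancestorSum κ ≗ lookup σ
    sum≗σ eq v = trans (sym (lookup-hookCombination κ v)) (cong (λ u → lookup u v) (sym eq))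
    compare : (eq? : Dec (σ ≡ hookCombination κ)) (tp? : Dec (IsTPartition T (lookup σ))) (b : Bool) →
      (increments σ ≗ᵇ κ) ≡ b → does eq? ≡ does tp? ∧ b
    compare (yes eq) (yes _)  true  _   = refl
    compare (yes eq) (yes _)  false b≡f
      with () ← trans (sym b≡f) (≗ᵇ-complete (increments σ) κ (proj₁ (ancestorSum-inverse σ κ (sum≗σ eq))))
    compare (yes eq) (no ¬tp) _     _   = ⊥-elim (¬tp (proj₂ (ancestorSum-inverse σ κ (sum≗σ eq))))
    compare (no ¬eq) (yes tp) true  b≡t = ⊥-elim (¬eq (sym (≗-lookup⇒≡ (hookCombination κ) σ (λ v →
      trans (lookup-hookCombination κ v)
        (trans (ancestorSum-cong (λ w → sym (≗ᵇ-sound (increments σ) κ b≡t w)) v) (ancestorSum-increments σ tp v))))))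
    compare (no ¬eq) (yes tp) false _   = refl
    compare (no ¬eq) (no _)   _     _   = refl

module Coefficient {n : ℕ} (T : RootedTree n) (a b : ℕ) (s : Exp (suc n)) where
  open Tree T

  e e₀ : Exp (Var (suc n))
  e  = a ∷ b ∷ s
  e₀ = a ∷ b ∷ zeroE

  K' : ℕ
  K' = totalDeg e

  open MultiSum K'

  isTP : Bool
  isTP = does (isTPartition? T (lookup s))

  fqtProd : (Vertex n → ℕ) → PS (Var (suc n))
  fqtProd κ = prodP (List.map (fqt ∘ κ) (allFin (suc n)))

  weight≡fqtProd : weight T (lookup s) ≡ fqtProd (increments s)
  weight≡fqtProd = sym (cong prodP (map-allFin-suc n (fqt ∘ increments s)))

  lhs-coefficient : lhsSeries T e ≡ ⟦ isTP ⟧ * weight T (lookup s) e₀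
  lhs-coefficient = begin
    ∑≤ s (λ σ → if TP σ then (W σ *P mono (0 ∷ 0 ∷ σ)) e else 0ℤ) ≡⟨ ∑≤-ext s (λ σ → summand σ (TP σ)) ⟩
    ∑≤ s (λ σ → mono s σ * (if TP σ then W σ e₀ else 0ℤ))         ≡⟨ ∑≤-mono-* s s _ ⟩
    (if does (s ≤E? s) then (if isTP then W s e₀ else 0ℤ) else 0ℤ)
      ≡⟨ cong (if_then (if isTP then W s e₀ else 0ℤ) else 0ℤ) (dec-true (s ≤E? s) (≤E-refl s)) ⟩
    (if isTP then W s e₀ else 0ℤ)                                 ≡⟨ if-then-0≡⟦⟧* isTP (W s e₀) ⟩
    ⟦ isTP ⟧ * W s e₀                                              ∎
    where
    TP : Exp (suc n) → Bool
    TP σ = does (isTPartition? T (lookup σ))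
    W : Exp (suc n) → PS (Var (suc n))
    W σ = weight T (lookup σ)
    summand : ∀ σ t → (if t then (W σ *P mono (0 ∷ 0 ∷ σ)) e else 0ℤ) ≡ mono s σ * (if t then W σ e₀ else 0ℤ)
    summand σ true  = zfree-*P-mono (W σ) (zfree-weight T (lookup σ)) a b σ s
    summand σ false = sym (ℤ.*-zeroʳ (mono s σ))

  hookTerm : Vertex n → ℕ → PS (Var (suc n))
  hookTerm v k = fqt k *P mono (0 ∷ 0 ∷ scaleE k (hookExp T v))

  hookTerms-coefficient : ∀ κ →
    prodP (List.map (λ v → hookTerm v (κ v)) (allFin (suc n))) e ≡ ⟦ isTP ⟧ * (⟦ increments s ≗ᵇ κ ⟧ * fqtProd κ e₀)
  hookTerms-coefficient κ = begin
    prodP (List.map (λ v → hookTerm v (κ v)) (allFin (suc n))) e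
      ≡⟨ prodP-*P-mono κ (hookExp T) (allFin (suc n)) e ⟩
    (fqtProd κ *P mono (0 ∷ 0 ∷ hookCombination κ)) e
      ≡⟨ zfree-*P-mono (fqtProd κ) (zfree-prodP (fqt ∘ κ) (λ v → zfree-fqt (κ v)) (allFin (suc n))) a b (hookCombination κ) s ⟩
    ⟦ does (s ≟E hookCombination κ) ⟧ * fqtProd κ e₀
      ≡⟨ cong (λ x → ⟦ x ⟧ * fqtProd κ e₀) (hookCombination-≟ s κ) ⟩
    ⟦ isTP ∧ (increments s ≗ᵇ κ) ⟧ * fqtProd κ e₀
      ≡⟨ trans (cong (_* fqtProd κ e₀) (⟦∧⟧ isTP _)) (ℤ.*-assoc ⟦ isTP ⟧ _ (fqtProd κ e₀)) ⟩
    ⟦ isTP ⟧ * (⟦ increments s ≗ᵇ κ ⟧ * fqtProd κ e₀) ∎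

  increments≤K' : ∀ v → increments s v ≤ K'
  increments≤K' Fin.zero    = ℕ.≤-trans (lookup≤tdeg s Fin.zero) (tdeg-∷∷ a b s)
  increments≤K' (Fin.suc i) = ℕ.≤-trans (ℕ.m∸n≤m _ (lookup s (parent T i)))
                                (ℕ.≤-trans (lookup≤tdeg s (Fin.suc i)) (tdeg-∷∷ a b s))

  rhs-coefficient : rhsSeries T e ≡ ⟦ isTP ⟧ * fqtProd (increments s) e₀
  rhs-coefficient = begin
    rhsSeries T e
      ≡⟨ prodP-agreeBelow (λ v → Fqt (hookExp T v)) (λ v → ∑ₚ (suc K') (hookTerm v))
           (λ v → QBinomial.Fqt-agreeBelow (hookExp T v) (1≤tdeg-hookExp v) K') (allFin (suc n)) e ℕ.≤-refl ⟩
    prodP (List.map (λ v → ∑ₚ (suc K') (hookTerm v)) (allFin (suc n))) e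
      ≡⟨ prodP-∑ₚ (suc n) hookTerm e ⟩
    ∑ᶠ (suc n) (λ κ → prodP (List.map (λ v → hookTerm v (κ v)) (allFin (suc n))) e)
      ≡⟨ ∑ᶠ-ext (suc n) hookTerms-coefficient ⟩
    ∑ᶠ (suc n) (λ κ → ⟦ isTP ⟧ * (⟦ increments s ≗ᵇ κ ⟧ * fqtProd κ e₀))
      ≡⟨ sym (*-∑ᶠ (suc n) ⟦ isTP ⟧ (λ κ → ⟦ increments s ≗ᵇ κ ⟧ * fqtProd κ e₀)) ⟩
    ⟦ isTP ⟧ * ∑ᶠ (suc n) (λ κ → ⟦ increments s ≗ᵇ κ ⟧ * fqtProd κ e₀)
      ≡⟨ cong (⟦ isTP ⟧ *_) (∑ᶠ-δ (suc n) (increments s) (λ κ → fqtProd κ e₀) fqtProd-resp increments≤K') ⟩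
    ⟦ isTP ⟧ * fqtProd (increments s) e₀ ∎
    where
    fqtProd-resp : ∀ κ κ' → κ ≗ κ' → fqtProd κ e₀ ≡ fqtProd κ' e₀
    fqtProd-resp κ κ' κ≗κ' = cong (λ xs → prodP xs e₀) (List.map-cong (cong fqt ∘ κ≗κ') (allFin (suc n)))

proposition4 : (n : ℕ) (T : RootedTree n) (e : Exp (Var (suc n))) →
                 lhsSeries T e ≡ rhsSeries T e
proposition4 n T (a ∷ b ∷ s) = begin
  lhsSeries T (a ∷ b ∷ s)                ≡⟨ lhs-coefficient ⟩
  ⟦ isTP ⟧ * weight T (lookup s) e₀      ≡⟨ cong (λ P → ⟦ isTP ⟧ * P e₀) weight≡fqtProd ⟩
  ⟦ isTP ⟧ * fqtProd (increments s) e₀   ≡⟨ sym rhs-coefficient ⟩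
  rhsSeries T (a ∷ b ∷ s)                ∎
  where
  open Coefficient T a b s
  open Tree T using (increments)
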